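{- Let $G$ be a connected finite simple graph of order $n\geq 3$. Then $\gamma_{\rm ri2}(G)=n-1$ if and only if $G$ is isomorphic to one of $S_{n-1}$, $S_{n-1}^+$, $S(n-3,1)$ (the latter with $n\geq 4$), and $C_5$.
   Context: A $2$-rainbow independent dominating function (2RiDF) of a graph $G$ is a function $f: V(G)\to\{0,1,2\}$ such that, writing $V_i=\{v: f(v)=i\}$, for each $i\in\{1,2\}$ the set $V_i$ is independent and every vertex $v$ with $f(v)=0$ has a neighbor $u$ with $f(u)=i$. Its weight is the number of vertices with nonzero value, and $\gamma_{\rm ri2}(G)$ is the minimum weight of a 2RiDF of $G$. The star $S_m$ ($m\geq 1$) is the complete bipartite graph $K_{1,m}$ (one center adjacent to $m$ leaves). $S_m^+$ is the graph obtained from $S_m$ by adding a single edge (necessarily joining two leaves). For integers $n\geq m\geq 0$, the double star $S(n,m)$ is the graph with vertex set $\{u_0,u_1,\ldots,u_n,v_0,v_1,\ldots,v_m\}$ and edge set $\{u_0v_0\}\cup\{u_0u_i: 1\le i\le n\}\cup\{v_0v_j:1\le j\le m\}$. $C_5$ is the cycle of length $5$. -}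

module Defs where

open import Data.Nat using (ℕ; zero; suc; _≤_; _≡ᵇ_; _+_; _∸_)
open import Data.Bool using (Bool; true; false; _∧_; _∨_; not)
open import Data.Fin using (Fin; toℕ)
open import Data.List using (List; map; allFin)
open import Data.Nat.ListAction using (sum)
open import Data.Product using (Σ; _×_; ∃; ∃-syntax; _,_)
open import Data.Empty using (⊥)
open import Relation.Binary.PropositionalEquality using (_≡_)
open import Function.Bundles using (_↔_; Inverse)

record Graph (n : ℕ) : Set where
  field
    adj    : Fin n → Fin n → Bool
    sym    : ∀ u v → adj u v ≡ adj v u
    irrefl : ∀ v → adj v v ≡ false

open Graph public

Edge : ∀ {n} → Graph n → Fin n → Fin n → Set
Edge G u v = adj G u v ≡ true

data Walk {n : ℕ} (G : Graph n) : Fin n → Fin n → Set where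
  here : ∀ {v} → Walk G v v
  step : ∀ {u w v} → Edge G u w → Walk G w v → Walk G u v

Connected : ∀ {n} → Graph n → Set
Connected {n} G = ∀ (u v : Fin n) → Walk G u v

data Label : Set where
  L0 L1 L2 : Label

nonzero : Label → ℕ
nonzero L0 = 0
nonzero L1 = 1
nonzero L2 = 1

record Is2RiDF {n : ℕ} (G : Graph n) (f : Fin n → Label) : Set where
  field
    indep₁ : ∀ u v → Edge G u v → f u ≡ L1 → f v ≡ L1 → ⊥
    indep₂ : ∀ u v → Edge G u v → f u ≡ L2 → f v ≡ L2 → ⊥
    dom₁   : ∀ v → f v ≡ L0 → ∃[ u ] (Edge G v u × f u ≡ L1)
    dom₂   : ∀ v → f v ≡ L0 → ∃[ u ] (Edge G v u × f u ≡ L2)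

weight : ∀ {n} → (Fin n → Label) → ℕ
weight {n} f = sum (map (λ v → nonzero (f v)) (allFin n))

γri2≡ : ∀ {n} → Graph n → ℕ → Set
γri2≡ {n} G k =
  (Σ (Fin n → Label) λ f → Is2RiDF G f × weight f ≡ k)
  × (∀ (f : Fin n → Label) → Is2RiDF G f → k ≤ weight f)

_≅_ : ∀ {n} → Graph n → (Fin n → Fin n → Bool) → Set
_≅_ {n} G H = Σ (Fin n ↔ Fin n) λ φ →
  ∀ u v → adj G u v ≡ H (Inverse.to φ u) (Inverse.to φ v)

private
  isZ : ∀ {n} → Fin n → Bool
  isZ v = toℕ v ≡ᵇ 0

  is : ∀ {n} → ℕ → Fin n → Bool
  is k v = toℕ v ≡ᵇ k

starAdj : ∀ {n} → Fin n → Fin n → Bool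
starAdj u v = (isZ u ∧ not (isZ v)) ∨ (isZ v ∧ not (isZ u))

starPlusAdj : ∀ {n} → Fin n → Fin n → Bool
starPlusAdj u v = starAdj u v ∨ ((is 1 u ∧ is 2 v) ∨ (is 2 u ∧ is 1 v))

-- Double star S(n-3,1) on Fin n (n ≥ 4): u₀ = 0, v₀ = 1, v₁ = 2,
-- leaves u₁..u_{n-3} = 3..n-1; edges 0–1, 1–2, and 0–k for k ≥ 3
doubleStarAdj : ∀ {n} → Fin n → Fin n → Bool
doubleStarAdj u v = e u v ∨ e v u
  where
    e : _ → _ → Bool
    e a b = (isZ a ∧ is 1 b) ∨ (is 1 a ∧ is 2 b)
            ∨ (isZ a ∧ not (isZ b ∨ is 1 b ∨ is 2 b))

cycleAdj : ∀ {n} → Fin n → Fin n → Bool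
cycleAdj {n} u v = e u v ∨ e v u
  where
    e : Fin n → Fin n → Bool
    e a b = (suc (toℕ a) ≡ᵇ toℕ b) ∨ ((suc (toℕ a) ≡ᵇ n) ∧ isZ b)

module Submission where

-- The weight of a 2RiDF is n minus its number of zeros, so γri2(G) = n − 1 says exactly that
-- some 2RiDF has a zero and none has two.  Suppose z₁ ≠ z₂ have neighbours a₁, b₁ and a₂, b₂
-- with a₁ ≁ a₂, b₁ ≁ b₂ and the obvious distinctness.  Labelling the a's by 1, the b's by 2
-- and z₁, z₂ by 0 is then a partial 2RiDF, and it extends greedily (give each remaining vertex
-- the first of 1, 2 missing from its neighbourhood, or 0 if both occur) to a 2RiDF with two
-- zeros.  In a connected graph without such a configuration, either some vertex dominates
-- (a star, or a star with one edge between leaves), or a non-dominating vertex has degree at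
-- least 3 (then the vertices at distance two form a single leaf and G is S(n − 3, 1)), or the
-- maximum degree is 2 (the path P₄ = S(1, 1) or C₅).  Conversely each of these graphs has a
-- 2RiDF with one zero.  A zero needs neighbours labelled 1 and 2, so leaves are never zeros and
-- a zero of degree two makes both its neighbours nonzero; in these graphs that leaves no room
-- for a second zero.


open import Defs
open import Data.Nat using (ℕ; _≥_; _∸_)
open import Data.Fin using (Fin)
open import Data.Sum using (_⊎_)
open import Data.Product using (_×_; Σ)
open import Relation.Binary.PropositionalEquality using (_≡_)
open import Function.Bundles using (_⇔_)

open import Data.Bool using (Bool; true; false; _∧_; _∨_; not; if_then_else_) renaming (_≟_ to _≟ᴮ_)
open import Data.Bool.Properties using (¬-not; ∨-comm; ∧-comm; T-≡)
open import Data.Empty using (⊥; ⊥-elim)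
open import Data.Fin using (toℕ; _≟_) renaming (zero to fzero; suc to fsuc)
open import Data.Fin.Patterns using (0F; 1F; 2F; 3F; 4F)
open import Data.Fin.Properties using (any?; all?; ¬∀⟶∃¬; 0≢1+n; suc-injective; toℕ-injective; injective⇒≤)
open import Data.Fin.Permutation as Perm using (Permutation′; _⟨$⟩ʳ_; _⟨$⟩ˡ_; _∘ₚ_)
open import Data.List using (List; []; _∷_; tabulate; allFin)
open import Data.List.Membership.Propositional using (_∈_)
open import Data.List.Membership.Propositional.Properties using (∈-allFin)
open import Data.List.Properties using (map-tabulate)
open import Data.List.Relation.Unary.Any using (here; there)
open import Data.Maybe using (Maybe; just; nothing)
open import Data.Maybe.Properties using (just-injective)
import Data.Maybe.Properties as Maybe
open import Data.Nat using (zero; suc; _≤_; _<_; _≡ᵇ_; z≤n; s≤s)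
open import Data.Nat.ListAction using (sum)
open import Data.Nat.Properties using (≤-refl; ≤-trans; ≤-antisym; +-mono-≤; +-monoˡ-≤; <⇒≱; ≡ᵇ⇒≡; ≡⇒≡ᵇ)
open import Data.Product using (∃; ∃-syntax; Σ-syntax; _,_; proj₁; proj₂)
open import Data.Sum using (inj₁; inj₂; [_,_]′)
open import Function.Base using (_∘_)
open import Function.Bundles using (Equivalence; mk↔ₛ′; mk⇔)
open import Relation.Binary.Definitions using (DecidableEquality)
open import Relation.Binary.PropositionalEquality as ≡ using (_≢_; ≢-sym; refl; trans; cong; cong₂; subst)
open import Relation.Nullary using (¬_; Dec; yes; no; does)
open import Relation.Nullary.Decidable
  using (map′; _×-dec_; _⊎-dec_; _→-dec_; ¬?; dec-true; dec-false; toWitness)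

_≟ᴸ_ : DecidableEquality Label
L0 ≟ᴸ L0 = yes refl
L0 ≟ᴸ L1 = no λ ()
L0 ≟ᴸ L2 = no λ ()
L1 ≟ᴸ L0 = no λ ()
L1 ≟ᴸ L1 = yes refl
L1 ≟ᴸ L2 = no λ ()
L2 ≟ᴸ L0 = no λ ()
L2 ≟ᴸ L1 = no λ ()
L2 ≟ᴸ L2 = yes refl

L1≢L2 : L1 ≢ L2
L1≢L2 ()

L1≢L0 : L1 ≢ L0
L1≢L0 ()

L2≢L0 : L2 ≢ L0
L2≢L0 ()

-- Weight and zeros

nonzero≤1 : ∀ l → nonzero l ≤ 1
nonzero≤1 L0 = z≤n
nonzero≤1 L1 = s≤s z≤n
nonzero≤1 L2 = s≤s z≤n

nonzero≡1 : ∀ {l} → l ≢ L0 → nonzero l ≡ 1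
nonzero≡1 {L0} l≢L0 = ⊥-elim (l≢L0 refl)
nonzero≡1 {L1} _ = refl
nonzero≡1 {L2} _ = refl

AtMostOneZero : ∀ {n} → (Fin n → Label) → Set
AtMostOneZero {n} f = ∀ {x y : Fin n} → f x ≡ L0 → f y ≡ L0 → x ≡ y

module Weight where

  weightᵗ : ∀ {n} → (Fin n → Label) → ℕ
  weightᵗ f = sum (tabulate (nonzero ∘ f))

  weight≡weightᵗ : ∀ {n} (f : Fin n → Label) → weight f ≡ weightᵗ f
  weight≡weightᵗ f = cong sum (map-tabulate (λ x → x) (nonzero ∘ f))

  weightᵗ≤n : ∀ {n} (f : Fin n → Label) → weightᵗ f ≤ n
  weightᵗ≤n {zero} f = z≤n
  weightᵗ≤n {suc n} f = +-mono-≤ (nonzero≤1 (f fzero)) (weightᵗ≤n (f ∘ fsuc))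

  weightᵗ-zeroFree : ∀ {n} (f : Fin n → Label) → (∀ v → f v ≢ L0) → weightᵗ f ≡ n
  weightᵗ-zeroFree {zero} f _ = refl
  weightᵗ-zeroFree {suc n} f f≢L0 rewrite nonzero≡1 (f≢L0 fzero) =
    cong suc (weightᵗ-zeroFree (f ∘ fsuc) (f≢L0 ∘ fsuc))

  weightᵗ<n : ∀ {n} (f : Fin n → Label) {x} → f x ≡ L0 → weightᵗ f < n
  weightᵗ<n {suc n} f {fzero} fx≡L0 rewrite fx≡L0 = s≤s (weightᵗ≤n (f ∘ fsuc))
  weightᵗ<n {suc n} f {fsuc x} fx≡L0 =
    ≤-trans (s≤s (+-monoˡ-≤ _ (nonzero≤1 (f fzero)))) (s≤s (weightᵗ<n (f ∘ fsuc) fx≡L0))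

  weightᵗ+2≤n : ∀ {n} (f : Fin n → Label) {x y} → f x ≡ L0 → f y ≡ L0 → x ≢ y →
                suc (suc (weightᵗ f)) ≤ n
  weightᵗ+2≤n {suc n} f {fzero} {fzero} _ _ x≢y = ⊥-elim (x≢y refl)
  weightᵗ+2≤n {suc n} f {fzero} {fsuc y} fx fy _ rewrite fx = s≤s (weightᵗ<n (f ∘ fsuc) fy)
  weightᵗ+2≤n {suc n} f {fsuc x} {fzero} fx fy _ rewrite fy = s≤s (weightᵗ<n (f ∘ fsuc) fx)
  weightᵗ+2≤n {suc n} f {fsuc x} {fsuc y} fx fy x≢y =
    ≤-trans (s≤s (s≤s (+-monoˡ-≤ _ (nonzero≤1 (f fzero)))))
            (s≤s (weightᵗ+2≤n (f ∘ fsuc) fx fy (x≢y ∘ cong fsuc)))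

  n≤1+weightᵗ : ∀ {n} (f : Fin n → Label) → AtMostOneZero f → n ≤ suc (weightᵗ f)
  n≤1+weightᵗ {zero} f _ = z≤n
  n≤1+weightᵗ {suc n} f unique with f fzero ≟ᴸ L0
  ... | yes f0≡L0
    rewrite f0≡L0 | weightᵗ-zeroFree (f ∘ fsuc) (λ v fv≡L0 → 0≢1+n (unique f0≡L0 fv≡L0)) = ≤-refl
  ... | no f0≢L0 rewrite nonzero≡1 f0≢L0 =
    s≤s (n≤1+weightᵗ (f ∘ fsuc) (λ fx fy → suc-injective (unique fx fy)))

open Weight using (weight≡weightᵗ; weightᵗ<n; weightᵗ+2≤n; n≤1+weightᵗ)

weight≡n∸1 : ∀ {n} (f : Fin n → Label) {x} → f x ≡ L0 → AtMostOneZero f → weight f ≡ n ∸ 1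
weight≡n∸1 {n} f fx≡L0 unique rewrite weight≡weightᵗ f =
  squeeze n (n≤1+weightᵗ f unique) (weightᵗ<n f fx≡L0)
  where
    squeeze : ∀ k {w} → k ≤ suc w → w < k → w ≡ k ∸ 1
    squeeze (suc k) (s≤s k≤w) (s≤s w≤k) = ≤-antisym w≤k k≤w

n∸1≤weight : ∀ {n} (f : Fin n → Label) → AtMostOneZero f → n ∸ 1 ≤ weight f
n∸1≤weight {n} f unique rewrite weight≡weightᵗ f = lower n (n≤1+weightᵗ f unique)
  where
    lower : ∀ k {w} → k ≤ suc w → k ∸ 1 ≤ w
    lower zero _ = z≤n
    lower (suc k) (s≤s k≤w) = k≤w

weight<n∸1 : ∀ {n} (f : Fin n → Label) {x y} → f x ≡ L0 → f y ≡ L0 → x ≢ y → weight f < n ∸ 1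
weight<n∸1 {n} f fx fy x≢y rewrite weight≡weightᵗ f = lower n (weightᵗ+2≤n f fx fy x≢y)
  where
    lower : ∀ k {w} → suc (suc w) ≤ k → suc w ≤ k ∸ 1
    lower (suc k) (s≤s 2+w≤k) = 2+w≤k

γri2≡n∸1 : ∀ {n} (G : Graph n) (f : Fin n → Label) {x} → Is2RiDF G f → f x ≡ L0 →
           (∀ g → Is2RiDF G g → AtMostOneZero g) → γri2≡ G (n ∸ 1)
γri2≡n∸1 G f f-2RiDF fx≡L0 unique =
  (f , f-2RiDF , weight≡n∸1 f fx≡L0 (unique f f-2RiDF)) , λ g g-2RiDF → n∸1≤weight g (unique g g-2RiDF)

γri2≡n∸1⇒atMostOneZero : ∀ {n} (G : Graph n) → γri2≡ G (n ∸ 1) →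
                         ∀ f → Is2RiDF G f → AtMostOneZero f
γri2≡n∸1⇒atMostOneZero G (_ , lowerBound) f f-2RiDF {x} {y} fx fy with x ≟ y
... | yes x≡y = x≡y
... | no x≢y = ⊥-elim (<⇒≱ (weight<n∸1 f fx fy x≢y) (lowerBound f f-2RiDF))

module GraphProperties {n : ℕ} (G : Graph n) where

  infix 4 _~_
  _~_ : Fin n → Fin n → Set
  _~_ = Edge G

  Edge-sym : ∀ {u v} → u ~ v → v ~ u
  Edge-sym {u} {v} e = trans (Graph.sym G v u) e

  Edge-irrefl : ∀ {v} → ¬ v ~ v
  Edge-irrefl {v} e with trans (≡.sym (Graph.irrefl G v)) e
  ... | ()

  Edge⇒≢ : ∀ {u v} → u ~ v → u ≢ v
  Edge⇒≢ e refl = Edge-irrefl e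

  Edge? : ∀ u v → Dec (Edge G u v)
  Edge? u v = adj G u v ≟ᴮ true

  onlyNeighbour : ∀ {a b} → ¬ (∃[ t ] (a ~ t × t ≢ b)) → ∀ t → a ~ t → t ≡ b
  onlyNeighbour {b = b} noOther t a~t with t ≟ b
  ... | yes t≡b = t≡b
  ... | no t≢b = ⊥-elim (noOther (t , a~t , t≢b))

  walk-closed : (P : Fin n → Set) → (∀ {a b} → P a → a ~ b → P b) → ∀ {u w} → Walk G u w → P u → P w
  walk-closed P closed here pu = pu
  walk-closed P closed (step e walk) pu = walk-closed P closed walk (closed pu e)

  leavingEdge : (P : Fin n → Set) → (∀ u → Dec (P u)) → ∀ {u w} → Walk G u w → P u → ¬ P w →
                ∃[ a ] ∃[ b ] (a ~ b × P a × ¬ P b)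
  leavingEdge P P? here pu ¬pw = ⊥-elim (¬pw pu)
  leavingEdge P P? (step {u} {w′} e walk) pu ¬pw with P? w′
  ... | yes pw′ = leavingEdge P P? walk pw′ ¬pw
  ... | no ¬pw′ = u , w′ , e , pu , ¬pw′

-- Greedy extension of partial labellings

PartialLabelling : ℕ → Set
PartialLabelling n = Fin n → Maybe Label

module GreedyExtension {n : ℕ} (G : Graph n) where
  open GraphProperties G

  HasNeighbourLabelled : PartialLabelling n → Fin n → Label → Set
  HasNeighbourLabelled s v l = ∃[ u ] (v ~ u × s u ≡ just l)

  hasNeighbourLabelled? : ∀ s v l → Dec (HasNeighbourLabelled s v l)
  hasNeighbourLabelled? s v l = any? (λ u → Edge? v u ×-dec Maybe.≡-dec _≟ᴸ_ (s u) (just l))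

  record IsPartial2RiDF (s : PartialLabelling n) : Set where
    field
      independent : ∀ {l u w} → l ≢ L0 → u ~ w → s u ≡ just l → s w ≡ just l → ⊥
      dominated   : ∀ {v} → s v ≡ just L0 →
                    HasNeighbourLabelled s v L1 × HasNeighbourLabelled s v L2

  missingLabel : ∀ {A B : Set} → Dec A → Dec B → Label
  missingLabel (no _)  _      = L1
  missingLabel (yes _) (no _) = L2
  missingLabel (yes _) (yes _) = L0

  missingLabel-L0 : ∀ {A B : Set} (a? : Dec A) (b? : Dec B) → missingLabel a? b? ≡ L0 → A × B
  missingLabel-L0 (yes a) (yes b) _ = a , b
  missingLabel-L0 (yes _) (no _) ()
  missingLabel-L0 (no _)  _      ()

  missingLabel-L1 : ∀ {A B : Set} (a? : Dec A) (b? : Dec B) → missingLabel a? b? ≡ L1 → ¬ A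
  missingLabel-L1 (no ¬a) _ _ = ¬a
  missingLabel-L1 (yes _) (no _) ()
  missingLabel-L1 (yes _) (yes _) ()

  missingLabel-L2 : ∀ {A B : Set} (a? : Dec A) (b? : Dec B) → missingLabel a? b? ≡ L2 → ¬ B
  missingLabel-L2 (yes _) (no ¬b) _ = ¬b
  missingLabel-L2 (yes _) (yes _) ()
  missingLabel-L2 (no _)  _       ()

  greedyLabel : PartialLabelling n → Fin n → Label
  greedyLabel s v = missingLabel (hasNeighbourLabelled? s v L1) (hasNeighbourLabelled? s v L2)

  greedyLabel-L0 : ∀ s v → greedyLabel s v ≡ L0 →
                   HasNeighbourLabelled s v L1 × HasNeighbourLabelled s v L2
  greedyLabel-L0 s v = missingLabel-L0 (hasNeighbourLabelled? s v L1) (hasNeighbourLabelled? s v L2)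

  greedyLabel-unseen : ∀ s v {l} → l ≢ L0 → greedyLabel s v ≡ l → ¬ HasNeighbourLabelled s v l
  greedyLabel-unseen s v {L0} l≢L0 _ = ⊥-elim (l≢L0 refl)
  greedyLabel-unseen s v {L1} _ = missingLabel-L1 (hasNeighbourLabelled? s v L1) _
  greedyLabel-unseen s v {L2} _ = missingLabel-L2 _ (hasNeighbourLabelled? s v L2)

  assign : PartialLabelling n → Fin n → Label → PartialLabelling n
  assign s v l u = if does (u ≟ v) then just l else s u

  assign-≡ : ∀ s v l → assign s v l v ≡ just l
  assign-≡ s v l rewrite dec-true (v ≟ v) refl = refl

  assign-inv : ∀ s v l {u l′} → assign s v l u ≡ just l′ → (u ≡ v × l ≡ l′) ⊎ s u ≡ just l′
  assign-inv s v l {u} e with u ≟ v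
  ... | yes refl = inj₁ (refl , just-injective e)
  ... | no _ = inj₂ e

  assign-unassigned : ∀ s {v} l {u l′} → s v ≡ nothing → s u ≡ just l′ → assign s v l u ≡ just l′
  assign-unassigned s {v} l {u} sv≡nothing su≡just with u ≟ v
  ... | yes refl with () ← trans (≡.sym sv≡nothing) su≡just
  ... | no _ = su≡just

  labelVertex : PartialLabelling n → Fin n → PartialLabelling n
  labelVertex s v with s v
  ... | just _  = s
  ... | nothing = assign s v (greedyLabel s v)

  labelVertex-mono : ∀ s v {u l} → s u ≡ just l → labelVertex s v u ≡ just l
  labelVertex-mono s v su≡just with s v in sv
  ... | just _  = su≡just
  ... | nothing = assign-unassigned s _ sv su≡just

  labelVertex-labels : ∀ s v → ∃[ l ] (labelVertex s v v ≡ just l)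
  labelVertex-labels s v with s v in sv
  ... | just l  = l , sv
  ... | nothing = _ , assign-≡ s v _

  labelVertex-preserves : ∀ s v → IsPartial2RiDF s → IsPartial2RiDF (labelVertex s v)
  labelVertex-preserves s v I with s v in sv
  ... | just _  = I
  ... | nothing = record { independent = independent′ ; dominated = dominated′ }
    where
      open IsPartial2RiDF I
      s′ = assign s v (greedyLabel s v)
      keep : ∀ {u l} → s u ≡ just l → s′ u ≡ just l
      keep = assign-unassigned s _ sv
      independent′ : ∀ {l u w} → l ≢ L0 → u ~ w → s′ u ≡ just l → s′ w ≡ just l → ⊥
      independent′ l≢L0 e su sw with assign-inv s v _ su | assign-inv s v _ sw
      ... | inj₁ (refl , gu) | inj₁ (refl , _) = Edge-irrefl e
      ... | inj₁ (refl , gu) | inj₂ sw′ = greedyLabel-unseen s _ l≢L0 gu (_ , e , sw′)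
      ... | inj₂ su′ | inj₁ (refl , gw) = greedyLabel-unseen s _ l≢L0 gw (_ , Edge-sym e , su′)
      ... | inj₂ su′ | inj₂ sw′ = independent l≢L0 e su′ sw′
      seen : ∀ {x l} → HasNeighbourLabelled s x l → HasNeighbourLabelled s′ x l
      seen (u , e , su) = u , e , keep su
      dominated′ : ∀ {x} → s′ x ≡ just L0 →
                   HasNeighbourLabelled s′ x L1 × HasNeighbourLabelled s′ x L2
      dominated′ sx with assign-inv s v _ sx
      ... | inj₁ (refl , g0) = let (n₁ , n₂) = greedyLabel-L0 s v g0 in seen n₁ , seen n₂
      ... | inj₂ sx′ = let (n₁ , n₂) = dominated sx′ in seen n₁ , seen n₂

  labelAll : PartialLabelling n → List (Fin n) → PartialLabelling n
  labelAll s [] = s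
  labelAll s (v ∷ vs) = labelAll (labelVertex s v) vs

  labelAll-mono : ∀ s vs {u l} → s u ≡ just l → labelAll s vs u ≡ just l
  labelAll-mono s [] e = e
  labelAll-mono s (v ∷ vs) e = labelAll-mono (labelVertex s v) vs (labelVertex-mono s v e)

  labelAll-preserves : ∀ s vs → IsPartial2RiDF s → IsPartial2RiDF (labelAll s vs)
  labelAll-preserves s [] I = I
  labelAll-preserves s (v ∷ vs) I = labelAll-preserves (labelVertex s v) vs (labelVertex-preserves s v I)

  labelAll-labels : ∀ s vs {v} → v ∈ vs → ∃[ l ] (labelAll s vs v ≡ just l)
  labelAll-labels s (v ∷ vs) (here refl) =
    let (l , e) = labelVertex-labels s v in l , labelAll-mono (labelVertex s v) vs e
  labelAll-labels s (w ∷ vs) (there v∈vs) = labelAll-labels (labelVertex s w) vs v∈vs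

  extend : ∀ {s} → IsPartial2RiDF s →
           Σ[ f ∈ (Fin n → Label) ] Is2RiDF G f × (∀ {v l} → s v ≡ just l → f v ≡ l)
  extend {s} I = f , f-2RiDF , λ e → fromTotal (labelAll-mono s (allFin n) e)
    where
      t = labelAll s (allFin n)
      open IsPartial2RiDF (labelAll-preserves s (allFin n) I)
      f : Fin n → Label
      f v = proj₁ (labelAll-labels s (allFin n) (∈-allFin v))
      toTotal : ∀ {v l} → f v ≡ l → t v ≡ just l
      toTotal {v} refl = proj₂ (labelAll-labels s (allFin n) (∈-allFin v))
      fromTotal : ∀ {v l} → t v ≡ just l → f v ≡ l
      fromTotal {v} e = just-injective (trans (≡.sym (toTotal {v} refl)) e)
      total : ∀ {v l} → HasNeighbourLabelled t v l → ∃[ u ] (v ~ u × f u ≡ l)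
      total (u , e , tu) = u , e , fromTotal tu
      f-2RiDF : Is2RiDF G f
      f-2RiDF = record
        { indep₁ = λ u v e fu fv → independent L1≢L0 e (toTotal fu) (toTotal fv)
        ; indep₂ = λ u v e fu fv → independent L2≢L0 e (toTotal fu) (toTotal fv)
        ; dom₁   = λ v fv → total (proj₁ (dominated (toTotal fv)))
        ; dom₂   = λ v fv → total (proj₂ (dominated (toTotal fv)))
        }

-- Two-zero configurations

record TwoZeroConfig {n : ℕ} (G : Graph n) (z₁ z₂ a₁ b₁ a₂ b₂ : Fin n) : Set where
  constructor twoZeroConfig
  field
    z₁≢z₂ : z₁ ≢ z₂
    z₁~a₁ : Edge G z₁ a₁
    z₁~b₁ : Edge G z₁ b₁
    z₂~a₂ : Edge G z₂ a₂
    z₂~b₂ : Edge G z₂ b₂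
    a₁≢b₁ : a₁ ≢ b₁
    a₁≢b₂ : a₁ ≢ b₂
    a₂≢b₁ : a₂ ≢ b₁
    a₂≢b₂ : a₂ ≢ b₂
    a₁≁a₂ : ¬ Edge G a₁ a₂
    b₁≁b₂ : ¬ Edge G b₁ b₂
    z₁≢a₂ : z₁ ≢ a₂
    z₁≢b₂ : z₁ ≢ b₂
    z₂≢a₁ : z₂ ≢ a₁
    z₂≢b₁ : z₂ ≢ b₁

NoTwoZeroConfig : ∀ {n} → Graph n → Set
NoTwoZeroConfig {n} G = ∀ {z₁ z₂ a₁ b₁ a₂ b₂ : Fin n} → ¬ TwoZeroConfig G z₁ z₂ a₁ b₁ a₂ b₂

data LabelClass (A B C : Set) : Label → Set where
  class₁ : A → LabelClass A B C L1
  class₂ : B → LabelClass A B C L2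
  class₀ : C → LabelClass A B C L0

module _ {A B C : Set} where

  classLabel : Dec A → Dec B → Dec C → Maybe Label
  classLabel (yes _) _       _       = just L1
  classLabel (no _)  (yes _) _       = just L2
  classLabel (no _)  (no _)  (yes _) = just L0
  classLabel (no _)  (no _)  (no _)  = nothing

  classLabel-inv : ∀ a? b? c? {l} → classLabel a? b? c? ≡ just l → LabelClass A B C l
  classLabel-inv (yes a) _       _       refl = class₁ a
  classLabel-inv (no _)  (yes b) _       refl = class₂ b
  classLabel-inv (no _)  (no _)  (yes c) refl = class₀ c
  classLabel-inv (no _)  (no _)  (no _)  ()

  classLabel-L1 : ∀ a? b? c? → A → classLabel a? b? c? ≡ just L1
  classLabel-L1 (yes _) _ _ _ = refl
  classLabel-L1 (no ¬a) _ _ a = ⊥-elim (¬a a)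

  classLabel-L2 : ∀ a? b? c? → ¬ A → B → classLabel a? b? c? ≡ just L2
  classLabel-L2 (yes a) _       _ ¬a _ = ⊥-elim (¬a a)
  classLabel-L2 (no _)  (yes _) _ _  _ = refl
  classLabel-L2 (no _)  (no ¬b) _ _  b = ⊥-elim (¬b b)

  classLabel-L0 : ∀ a? b? c? → ¬ A → ¬ B → C → classLabel a? b? c? ≡ just L0
  classLabel-L0 (yes a) _       _       ¬a _  _ = ⊥-elim (¬a a)
  classLabel-L0 (no _)  (yes b) _       _  ¬b _ = ⊥-elim (¬b b)
  classLabel-L0 (no _)  (no _)  (yes _) _  _  _ = refl
  classLabel-L0 (no _)  (no _)  (no ¬c) _  _  c = ⊥-elim (¬c c)

module _ {n : ℕ} {G : Graph n} {z₁ z₂ a₁ b₁ a₂ b₂ : Fin n} (c : TwoZeroConfig G z₁ z₂ a₁ b₁ a₂ b₂) where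
  open TwoZeroConfig c
  open GraphProperties G
  open GreedyExtension G

  configLabelling : PartialLabelling n
  configLabelling u = classLabel (u ≟ a₁ ⊎-dec u ≟ a₂) (u ≟ b₁ ⊎-dec u ≟ b₂) (u ≟ z₁ ⊎-dec u ≟ z₂)

  private
    label₁ : ∀ {u} → u ≡ a₁ ⊎ u ≡ a₂ → configLabelling u ≡ just L1
    label₁ {u} = classLabel-L1 (u ≟ a₁ ⊎-dec u ≟ a₂) (u ≟ b₁ ⊎-dec u ≟ b₂) (u ≟ z₁ ⊎-dec u ≟ z₂)

    label₂ : ∀ {u} → ¬ (u ≡ a₁ ⊎ u ≡ a₂) → u ≡ b₁ ⊎ u ≡ b₂ → configLabelling u ≡ just L2
    label₂ {u} = classLabel-L2 (u ≟ a₁ ⊎-dec u ≟ a₂) (u ≟ b₁ ⊎-dec u ≟ b₂) (u ≟ z₁ ⊎-dec u ≟ z₂)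

    label₀ : ∀ {u} → ¬ (u ≡ a₁ ⊎ u ≡ a₂) → ¬ (u ≡ b₁ ⊎ u ≡ b₂) → u ≡ z₁ ⊎ u ≡ z₂ →
             configLabelling u ≡ just L0
    label₀ {u} = classLabel-L0 (u ≟ a₁ ⊎-dec u ≟ a₂) (u ≟ b₁ ⊎-dec u ≟ b₂) (u ≟ z₁ ⊎-dec u ≟ z₂)

    class : ∀ {u l} → configLabelling u ≡ just l →
            LabelClass (u ≡ a₁ ⊎ u ≡ a₂) (u ≡ b₁ ⊎ u ≡ b₂) (u ≡ z₁ ⊎ u ≡ z₂) l
    class {u} = classLabel-inv (u ≟ a₁ ⊎-dec u ≟ a₂) (u ≟ b₁ ⊎-dec u ≟ b₂) (u ≟ z₁ ⊎-dec u ≟ z₂)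

    b₁≡ : configLabelling b₁ ≡ just L2
    b₁≡ = label₂ [ a₁≢b₁ ∘ ≡.sym , a₂≢b₁ ∘ ≡.sym ]′ (inj₁ refl)

    b₂≡ : configLabelling b₂ ≡ just L2
    b₂≡ = label₂ [ a₁≢b₂ ∘ ≡.sym , a₂≢b₂ ∘ ≡.sym ]′ (inj₂ refl)

  configLabelling-z₁ : configLabelling z₁ ≡ just L0
  configLabelling-z₁ = label₀ [ Edge⇒≢ z₁~a₁ , z₁≢a₂ ]′ [ Edge⇒≢ z₁~b₁ , z₁≢b₂ ]′ (inj₁ refl)

  configLabelling-z₂ : configLabelling z₂ ≡ just L0
  configLabelling-z₂ = label₀ [ z₂≢a₁ , Edge⇒≢ z₂~a₂ ]′ [ z₂≢b₁ , Edge⇒≢ z₂~b₂ ]′ (inj₂ refl)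

  configLabelling-isPartial2RiDF : IsPartial2RiDF configLabelling
  configLabelling-isPartial2RiDF = record { independent = independent ; dominated = dominated }
    where
      independent : ∀ {l u w} → l ≢ L0 → u ~ w →
                    configLabelling u ≡ just l → configLabelling w ≡ just l → ⊥
      independent l≢L0 e su sw with class su | class sw
      ... | class₁ (inj₁ refl) | class₁ (inj₁ refl) = Edge-irrefl e
      ... | class₁ (inj₁ refl) | class₁ (inj₂ refl) = a₁≁a₂ e
      ... | class₁ (inj₂ refl) | class₁ (inj₁ refl) = a₁≁a₂ (Edge-sym e)
      ... | class₁ (inj₂ refl) | class₁ (inj₂ refl) = Edge-irrefl e
      ... | class₂ (inj₁ refl) | class₂ (inj₁ refl) = Edge-irrefl e
      ... | class₂ (inj₁ refl) | class₂ (inj₂ refl) = b₁≁b₂ e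
      ... | class₂ (inj₂ refl) | class₂ (inj₁ refl) = b₁≁b₂ (Edge-sym e)
      ... | class₂ (inj₂ refl) | class₂ (inj₂ refl) = Edge-irrefl e
      ... | class₀ _ | _ = l≢L0 refl
      dominated : ∀ {v} → configLabelling v ≡ just L0 →
                  HasNeighbourLabelled configLabelling v L1 × HasNeighbourLabelled configLabelling v L2
      dominated sv with class sv
      ... | class₀ (inj₁ refl) = (a₁ , z₁~a₁ , label₁ (inj₁ refl)) , (b₁ , z₁~b₁ , b₁≡)
      ... | class₀ (inj₂ refl) = (a₂ , z₂~a₂ , label₁ (inj₂ refl)) , (b₂ , z₂~b₂ , b₂≡)

noTwoZeroConfig : ∀ {n} (G : Graph n) → (∀ f → Is2RiDF G f → AtMostOneZero f) → NoTwoZeroConfig G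
noTwoZeroConfig G unique c =
  let (f , f-2RiDF , agrees) = GreedyExtension.extend G (configLabelling-isPartial2RiDF c)
  in TwoZeroConfig.z₁≢z₂ c (unique f f-2RiDF (agrees (configLabelling-z₁ c)) (agrees (configLabelling-z₂ c)))

-- Recognising the four graphs up to isomorphism

isAt : ∀ {n} → Fin n → Fin n → Bool
isAt c u = does (u ≟ c)

isAt-≡ : ∀ {n} {c u : Fin n} → u ≡ c → isAt c u ≡ true
isAt-≡ {c = c} {u} = dec-true (u ≟ c)

isAt-≢ : ∀ {n} {c u : Fin n} → u ≢ c → isAt c u ≡ false
isAt-≢ {c = c} {u} = dec-false (u ≟ c)

isIndex : ∀ {n} → ℕ → Fin n → Bool
isIndex k u = toℕ u ≡ᵇ k

module SendToFront {n : ℕ} where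

  ⟨$⟩ʳ-injective : ∀ (π : Permutation′ n) {x y} → π ⟨$⟩ʳ x ≡ π ⟨$⟩ʳ y → x ≡ y
  ⟨$⟩ʳ-injective π e = trans (≡.sym (Perm.inverseˡ π)) (trans (cong (π ⟨$⟩ˡ_) e) (Perm.inverseˡ π))

  sendTo : Permutation′ n → Fin n → Fin n → Permutation′ n
  sendTo π c t = π ∘ₚ Perm.transpose (π ⟨$⟩ʳ c) t

  sendTo-here : ∀ π c t → sendTo π c t ⟨$⟩ʳ c ≡ t
  sendTo-here π c t rewrite dec-true (π ⟨$⟩ʳ c ≟ π ⟨$⟩ʳ c) refl = refl

  sendTo-there : ∀ π {c t d} → d ≢ c → π ⟨$⟩ʳ d ≢ t → sendTo π c t ⟨$⟩ʳ d ≡ π ⟨$⟩ʳ d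
  sendTo-there π {c} {t} {d} d≢c πd≢t
    rewrite dec-false (π ⟨$⟩ʳ d ≟ π ⟨$⟩ʳ c) (d≢c ∘ ⟨$⟩ʳ-injective π)
          | dec-false (π ⟨$⟩ʳ d ≟ t) πd≢t = refl

  isAt-sent : ∀ (π : Permutation′ n) {c t} → π ⟨$⟩ʳ c ≡ t →
              ∀ u → isIndex (toℕ t) (π ⟨$⟩ʳ u) ≡ isAt c u
  isAt-sent π {c} {t} πc≡t u with u ≟ c
  ... | yes refl rewrite πc≡t = Equivalence.to T-≡ (≡⇒≡ᵇ (toℕ t) (toℕ t) refl)
  ... | no u≢c = ¬-not λ e →
    u≢c (⟨$⟩ʳ-injective π (trans (toℕ-injective (≡ᵇ⇒≡ _ _ (Equivalence.from T-≡ e))) (≡.sym πc≡t)))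

Pattern₃ : Set
Pattern₃ = Bool → Bool → Bool → Bool → Bool → Bool → Bool

-- Evaluated at the indicators of the vertices 0, 1 and 2 of both endpoints,
-- these patterns are definitionally starAdj, starPlusAdj and doubleStarAdj.
starPattern : Bool → Bool → Bool
starPattern z z′ = (z ∧ not z′) ∨ (z′ ∧ not z)

starPlusPattern : Pattern₃
starPlusPattern z o t z′ o′ t′ = starPattern z z′ ∨ ((o ∧ t′) ∨ (t ∧ o′))

doubleStarArc : Pattern₃
doubleStarArc z o t z′ o′ t′ = (z ∧ o′) ∨ (o ∧ t′) ∨ (z ∧ not (z′ ∨ o′ ∨ t′))

doubleStarPattern : Pattern₃
doubleStarPattern z o t z′ o′ t′ = doubleStarArc z o t z′ o′ t′ ∨ doubleStarArc z′ o′ t′ z o t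

starPattern-sym : ∀ z z′ → starPattern z z′ ≡ starPattern z′ z
starPattern-sym z z′ = ∨-comm (z ∧ not z′) (z′ ∧ not z)

starPlusPattern-sym : ∀ z o t z′ o′ t′ → starPlusPattern z o t z′ o′ t′ ≡ starPlusPattern z′ o′ t′ z o t
starPlusPattern-sym z o t z′ o′ t′ =
  cong₂ _∨_ (starPattern-sym z z′) (trans (∨-comm (o ∧ t′) (t ∧ o′)) (cong₂ _∨_ (∧-comm t o′) (∧-comm o t′)))

doubleStarPattern-sym : ∀ z o t z′ o′ t′ → doubleStarPattern z o t z′ o′ t′ ≡ doubleStarPattern z′ o′ t′ z o t
doubleStarPattern-sym z o t z′ o′ t′ = ∨-comm (doubleStarArc z o t z′ o′ t′) (doubleStarArc z′ o′ t′ z o t)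

cong₆ : (P : Pattern₃) {a b c d e f a′ b′ c′ d′ e′ f′ : Bool} →
        a ≡ a′ → b ≡ b′ → c ≡ c′ → d ≡ d′ → e ≡ e′ → f ≡ f′ → P a b c d e f ≡ P a′ b′ c′ d′ e′ f′
cong₆ P refl refl refl refl refl refl = refl

module _ {n : ℕ} (G : Graph (suc n)) where
  open SendToFront

  ≅-starPattern : ∀ c → (∀ u v → adj G u v ≡ starPattern (isAt c u) (isAt c v)) → G ≅ starAdj
  ≅-starPattern c table = π , λ u v →
    trans (table u v) (≡.sym (cong₂ starPattern (isAt-sent π (sendTo-here Perm.id c fzero) u)
                                                  (isAt-sent π (sendTo-here Perm.id c fzero) v)))
    where
      π = sendTo Perm.id c fzero

data Role : Set where
  role₀ role₁ role₂ other : Role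

is₀ is₁ is₂ : Role → Bool
is₀ role₀ = true
is₀ _     = false
is₁ role₁ = true
is₁ _     = false
is₂ role₂ = true
is₂ _     = false

module Roles {m : ℕ} (G : Graph (suc (suc (suc m)))) (c₀ c₁ c₂ : Fin (suc (suc (suc m))))
         (c₀≢c₁ : c₀ ≢ c₁) (c₀≢c₂ : c₀ ≢ c₂) (c₁≢c₂ : c₁ ≢ c₂) where
  open SendToFront

  private
    π₁ π₂ π : Permutation′ (suc (suc (suc m)))
    π₁ = sendTo Perm.id c₀ fzero
    π₂ = sendTo π₁ c₁ (fsuc fzero)
    π  = sendTo π₂ c₂ (fsuc (fsuc fzero))

    π₂c₀ : π₂ ⟨$⟩ʳ c₀ ≡ fzero
    π₂c₀ = trans (sendTo-there π₁ c₀≢c₁ (λ e → 0≢1+n (trans (≡.sym (sendTo-here Perm.id c₀ fzero)) e)))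
                 (sendTo-here Perm.id c₀ fzero)

    πc₀ : π ⟨$⟩ʳ c₀ ≡ fzero
    πc₀ = trans (sendTo-there π₂ c₀≢c₂ (λ e → 0≢1+n (trans (≡.sym π₂c₀) e))) π₂c₀

    πc₁ : π ⟨$⟩ʳ c₁ ≡ fsuc fzero
    πc₁ = trans (sendTo-there π₂ c₁≢c₂ (λ e → 0≢1+n (suc-injective (trans (≡.sym π₂c₁) e)))) π₂c₁
      where
        π₂c₁ = sendTo-here π₁ c₁ (fsuc fzero)

    πc₂ : π ⟨$⟩ʳ c₂ ≡ fsuc (fsuc fzero)
    πc₂ = sendTo-here π₂ c₂ (fsuc (fsuc fzero))

    ≅-pattern : (P : Pattern₃) →
      (∀ u v → adj G u v ≡ P (isAt c₀ u) (isAt c₁ u) (isAt c₂ u) (isAt c₀ v) (isAt c₁ v) (isAt c₂ v)) →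
      ∀ u v → adj G u v ≡ P (isIndex 0 (π ⟨$⟩ʳ u)) (isIndex 1 (π ⟨$⟩ʳ u)) (isIndex 2 (π ⟨$⟩ʳ u))
                            (isIndex 0 (π ⟨$⟩ʳ v)) (isIndex 1 (π ⟨$⟩ʳ v)) (isIndex 2 (π ⟨$⟩ʳ v))
    ≅-pattern P table u v = trans (table u v) (≡.sym (cong₆ P (at₀ u) (at₁ u) (at₂ u) (at₀ v) (at₁ v) (at₂ v)))
      where
        at₀ = isAt-sent π πc₀
        at₁ = isAt-sent π πc₁
        at₂ = isAt-sent π πc₂

  HasRole : Role → Fin (suc (suc (suc m))) → Set
  HasRole role₀ u = u ≡ c₀
  HasRole role₁ u = u ≡ c₁
  HasRole role₂ u = u ≡ c₂
  HasRole other u = u ≢ c₀ × u ≢ c₁ × u ≢ c₂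

  private
    roleOf : ∀ u → Σ[ r ∈ Role ] HasRole r u ×
             isAt c₀ u ≡ is₀ r × isAt c₁ u ≡ is₁ r × isAt c₂ u ≡ is₂ r
    roleOf u = decide (u ≟ c₀) (u ≟ c₁) (u ≟ c₂)
      where
        decide : Dec (u ≡ c₀) → Dec (u ≡ c₁) → Dec (u ≡ c₂) →
                 Σ[ r ∈ Role ] HasRole r u × isAt c₀ u ≡ is₀ r × isAt c₁ u ≡ is₁ r × isAt c₂ u ≡ is₂ r
        decide (yes refl) _ _ = role₀ , refl , isAt-≡ {c = c₀} refl , isAt-≢ c₀≢c₁ , isAt-≢ c₀≢c₂
        decide (no u≢c₀) (yes refl) _ = role₁ , refl , isAt-≢ u≢c₀ , isAt-≡ {c = c₁} refl , isAt-≢ c₁≢c₂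
        decide (no u≢c₀) (no u≢c₁) (yes refl) = role₂ , refl , isAt-≢ u≢c₀ , isAt-≢ u≢c₁ , isAt-≡ {c = c₂} refl
        decide (no u≢c₀) (no u≢c₁) (no u≢c₂) =
          other , (u≢c₀ , u≢c₁ , u≢c₂) , isAt-≢ u≢c₀ , isAt-≢ u≢c₁ , isAt-≢ u≢c₂

  RoleTable : Pattern₃ → Set
  RoleTable P = ∀ r r′ {u v} → HasRole r u → HasRole r′ v →
                adj G u v ≡ P (is₀ r) (is₁ r) (is₂ r) (is₀ r′) (is₁ r′) (is₂ r′)

  private
    byRoles : ∀ P → RoleTable P →
      ∀ u v → adj G u v ≡ P (isAt c₀ u) (isAt c₁ u) (isAt c₂ u) (isAt c₀ v) (isAt c₁ v) (isAt c₂ v)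
    byRoles P table u v with roleOf u | roleOf v
    ... | r , u∈r , e₀ , e₁ , e₂ | r′ , v∈r′ , e₀′ , e₁′ , e₂′ =
      trans (table r r′ u∈r v∈r′) (≡.sym (cong₆ P e₀ e₁ e₂ e₀′ e₁′ e₂′))

  ≅-starPlusByRoles : RoleTable starPlusPattern → G ≅ starPlusAdj
  ≅-starPlusByRoles table = π , ≅-pattern starPlusPattern (byRoles starPlusPattern table)

  ≅-doubleStarByRoles : RoleTable doubleStarPattern → G ≅ doubleStarAdj
  ≅-doubleStarByRoles table = π , ≅-pattern doubleStarPattern (byRoles doubleStarPattern table)

module Enumeration {n k : ℕ} (v : Fin k → Fin n) (v-injective : ∀ {i j} → v i ≡ v j → i ≡ j)
                   (v-onto : ∀ u → ∃[ i ] v i ≡ u) where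

  index : Fin n → Fin k
  index u = proj₁ (v-onto u)

  v∘index : ∀ u → v (index u) ≡ u
  v∘index u = proj₂ (v-onto u)

  index∘v : ∀ i → index (v i) ≡ i
  index∘v i = v-injective (v∘index (v i))

  enumeration-size : n ≡ k
  enumeration-size = ≤-antisym
    (injective⇒≤ {f = index} λ {u} {w} e → trans (≡.sym (v∘index u)) (trans (cong v e) (v∘index w)))
    (injective⇒≤ {f = v} v-injective)

≅-enumeration : ∀ {n} (G : Graph n) (H : Fin n → Fin n → Bool) (v : Fin n → Fin n) →
                (v-injective : ∀ {i j} → v i ≡ v j → i ≡ j) (v-onto : ∀ u → ∃[ i ] v i ≡ u) →
                (∀ i j → adj G (v i) (v j) ≡ H i j) → G ≅ H
≅-enumeration G H v v-injective v-onto table = mk↔ₛ′ index v index∘v v∘index , λ u w →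
  trans (cong₂ (adj G) (≡.sym (v∘index u)) (≡.sym (v∘index w))) (table (index u) (index w))
  where open Enumeration v v-injective v-onto

cycle₅-separated : ∀ (i j : Fin 5) → i ≡ j ⊎ ∃[ k ] cycleAdj i k ≢ cycleAdj j k
cycle₅-separated = toWitness {a? = all? λ i → all? λ j →
  (i ≟ j) ⊎-dec any? (λ k → ¬? (cycleAdj i k ≟ᴮ cycleAdj j k))} _

enumeration-injective : ∀ {n k} (G : Graph n) (H : Fin k → Fin k → Bool) (v : Fin k → Fin n) →
  (∀ i j → i ≡ j ⊎ ∃[ l ] H i l ≢ H j l) → (∀ i j → adj G (v i) (v j) ≡ H i j) →
  ∀ {i j} → v i ≡ v j → i ≡ j
enumeration-injective G H v separated table {i} {j} vi≡vj with separated i j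
... | inj₁ i≡j = i≡j
... | inj₂ (l , Hil≢Hjl) =
  ⊥-elim (Hil≢Hjl (trans (≡.sym (table i l)) (trans (cong (λ u → adj G u (v l)) vi≡vj) (table j l))))

≅-cycle₅ : ∀ {n} (G : Graph n) (v : Fin 5 → Fin n) → (∀ u → ∃[ i ] v i ≡ u) →
           (∀ i j → adj G (v i) (v j) ≡ cycleAdj i j) → (n ≡ 5) × (G ≅ cycleAdj)
≅-cycle₅ G v v-onto table with enumeration-injective G cycleAdj v cycle₅-separated table
... | v-injective with Enumeration.enumeration-size v v-injective v-onto
...   | refl = refl , ≅-enumeration G cycleAdj v v-injective v-onto table

distinct₄⇒4≤n : ∀ {n} (a b c d : Fin n) → a ≢ b → a ≢ c → a ≢ d → b ≢ c → b ≢ d → c ≢ d → 4 ≤ n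
distinct₄⇒4≤n {n} a b c d a≢b a≢c a≢d b≢c b≢d c≢d = injective⇒≤ {f = list} injective
  where
    list : Fin 4 → Fin n
    list 0F = a
    list 1F = b
    list 2F = c
    list 3F = d
    injective : ∀ {i j} → list i ≡ list j → i ≡ j
    injective {0F} {0F} _ = refl
    injective {0F} {1F} e = ⊥-elim (a≢b e)
    injective {0F} {2F} e = ⊥-elim (a≢c e)
    injective {0F} {3F} e = ⊥-elim (a≢d e)
    injective {1F} {0F} e = ⊥-elim (a≢b (≡.sym e))
    injective {1F} {1F} _ = refl
    injective {1F} {2F} e = ⊥-elim (b≢c e)
    injective {1F} {3F} e = ⊥-elim (b≢d e)
    injective {2F} {0F} e = ⊥-elim (a≢c (≡.sym e))
    injective {2F} {1F} e = ⊥-elim (b≢c (≡.sym e))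
    injective {2F} {2F} _ = refl
    injective {2F} {3F} e = ⊥-elim (c≢d e)
    injective {3F} {0F} e = ⊥-elim (a≢d (≡.sym e))
    injective {3F} {1F} e = ⊥-elim (b≢d (≡.sym e))
    injective {3F} {2F} e = ⊥-elim (c≢d (≡.sym e))
    injective {3F} {3F} _ = refl

module Recognition {m : ℕ} (G : Graph (suc (suc (suc m)))) where
  open GraphProperties G

  private
    V = Fin (suc (suc (suc m)))

  ≅-star : ∀ c → (∀ u → u ≢ c → c ~ u) → (∀ s t → s ≢ c → t ≢ c → ¬ s ~ t) → G ≅ starAdj
  ≅-star c dominating leavesIndependent = ≅-starPattern G c table
    where
      table : ∀ u v → adj G u v ≡ starPattern (isAt c u) (isAt c v)
      table u v = decide (u ≟ c) (v ≟ c)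
        where
          decide : Dec (u ≡ c) → Dec (v ≡ c) → adj G u v ≡ starPattern (isAt c u) (isAt c v)
          decide (yes refl) (yes refl) rewrite isAt-≡ {c = c} refl = ¬-not Edge-irrefl
          decide (yes refl) (no v≢c) rewrite isAt-≡ {c = c} refl | isAt-≢ v≢c = dominating v v≢c
          decide (no u≢c) (yes refl) rewrite isAt-≡ {c = c} refl | isAt-≢ u≢c = Edge-sym (dominating u u≢c)
          decide (no u≢c) (no v≢c) rewrite isAt-≢ u≢c | isAt-≢ v≢c = ¬-not (leavesIndependent u v u≢c v≢c)

  ≅-starPlus : ∀ c x y → c ≢ x → c ≢ y → x ≢ y → (∀ u → u ≢ c → c ~ u) → x ~ y →
    (∀ w → w ≢ c → w ≢ x → w ≢ y → ¬ x ~ w) →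
    (∀ w → w ≢ c → w ≢ x → w ≢ y → ¬ y ~ w) →
    (∀ s t → s ≢ c → s ≢ x → s ≢ y → t ≢ c → t ≢ x → t ≢ y → ¬ s ~ t) →
    G ≅ starPlusAdj
  ≅-starPlus c x y c≢x c≢y x≢y dominating x~y xPrivate yPrivate rest =
    ≅-starPlusByRoles table
    where
      open Roles G c x y c≢x c≢y x≢y
      table : RoleTable starPlusPattern
      table role₀ role₀ refl refl = ¬-not Edge-irrefl
      table role₀ role₁ refl refl = dominating x (c≢x ∘ ≡.sym)
      table role₀ role₂ refl refl = dominating y (c≢y ∘ ≡.sym)
      table role₀ other refl (w≢c , _) = dominating _ w≢c
      table role₁ role₀ refl refl = Edge-sym (dominating x (c≢x ∘ ≡.sym))
      table role₁ role₁ refl refl = ¬-not Edge-irrefl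
      table role₁ role₂ refl refl = x~y
      table role₁ other refl (w≢c , w≢x , w≢y) = ¬-not (xPrivate _ w≢c w≢x w≢y)
      table role₂ role₀ refl refl = Edge-sym (dominating y (c≢y ∘ ≡.sym))
      table role₂ role₁ refl refl = Edge-sym x~y
      table role₂ role₂ refl refl = ¬-not Edge-irrefl
      table role₂ other refl (w≢c , w≢x , w≢y) = ¬-not (yPrivate _ w≢c w≢x w≢y)
      table other role₀ (u≢c , _) refl = Edge-sym (dominating _ u≢c)
      table other role₁ (u≢c , u≢x , u≢y) refl = ¬-not (xPrivate _ u≢c u≢x u≢y ∘ Edge-sym)
      table other role₂ (u≢c , u≢x , u≢y) refl = ¬-not (yPrivate _ u≢c u≢x u≢y ∘ Edge-sym)
      table other other (u≢c , u≢x , u≢y) (w≢c , w≢x , w≢y) = ¬-not (rest _ _ u≢c u≢x u≢y w≢c w≢x w≢y)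

  ≅-doubleStar : ∀ c v y d → c ≢ v → c ≢ y → v ≢ y → d ≢ c → d ≢ v → d ≢ y →
    c ~ v → v ~ y → ¬ c ~ y →
    (∀ t → y ~ t → t ≡ v) →
    (∀ t → v ~ t → t ≡ c ⊎ t ≡ y) →
    (∀ w → w ≢ y → w ≢ c → c ~ w) →
    (∀ s t → s ≢ c → s ≢ v → s ≢ y → t ≢ c → t ≢ v → t ≢ y → ¬ s ~ t) →
    (suc (suc (suc m)) ≥ 4) × (G ≅ doubleStarAdj)
  ≅-doubleStar c v y d c≢v c≢y v≢y d≢c d≢v d≢y c~v v~y c≁y yLeaf vNeighbours cDominates rest =
    distinct₄⇒4≤n c v y d c≢v c≢y (d≢c ∘ ≡.sym) v≢y (d≢v ∘ ≡.sym) (d≢y ∘ ≡.sym) ,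
    ≅-doubleStarByRoles table
    where
      open Roles G c v y c≢v c≢y v≢y
      v≁ : ∀ {t} → t ≢ c → t ≢ y → ¬ v ~ t
      v≁ t≢c t≢y v~t = [ t≢c , t≢y ]′ (vNeighbours _ v~t)
      y≁ : ∀ {t} → t ≢ v → ¬ y ~ t
      y≁ t≢v y~t = t≢v (yLeaf _ y~t)
      table : RoleTable doubleStarPattern
      table role₀ role₀ refl refl = ¬-not Edge-irrefl
      table role₀ role₁ refl refl = c~v
      table role₀ role₂ refl refl = ¬-not c≁y
      table role₀ other refl (w≢c , _ , w≢y) = cDominates _ w≢y w≢c
      table role₁ role₀ refl refl = Edge-sym c~v
      table role₁ role₁ refl refl = ¬-not Edge-irrefl
      table role₁ role₂ refl refl = v~y
      table role₁ other refl (w≢c , _ , w≢y) = ¬-not (v≁ w≢c w≢y)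
      table role₂ role₀ refl refl = ¬-not (c≁y ∘ Edge-sym)
      table role₂ role₁ refl refl = Edge-sym v~y
      table role₂ role₂ refl refl = ¬-not Edge-irrefl
      table role₂ other refl (_ , w≢v , _) = ¬-not (y≁ w≢v)
      table other role₀ (u≢c , _ , u≢y) refl = Edge-sym (cDominates _ u≢y u≢c)
      table other role₁ (u≢c , _ , u≢y) refl = ¬-not (v≁ u≢c u≢y ∘ Edge-sym)
      table other role₂ (_ , u≢v , _) refl = ¬-not (y≁ u≢v ∘ Edge-sym)
      table other other (u≢c , u≢v , u≢y) (w≢c , w≢v , w≢y) = ¬-not (rest _ _ u≢c u≢v u≢y w≢c w≢v w≢y)

-- Classification of connected graphs without two-zero configurations

Family : ∀ {n} → Graph n → Set
Family {n} G = (G ≅ starAdj) ⊎ (G ≅ starPlusAdj) ⊎ ((n ≥ 4) × (G ≅ doubleStarAdj))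
               ⊎ ((n ≡ 5) × (G ≅ cycleAdj))

module Classification {m : ℕ} (G : Graph (suc (suc (suc m)))) (noConfig : NoTwoZeroConfig G)
                      (connected : Connected G) where
  open GraphProperties G
  open Recognition G

  private
    V = Fin (suc (suc (suc m)))

  Dominating : V → Set
  Dominating c = ∀ u → u ≢ c → c ~ u

  NotDominating : V → Set
  NotDominating c = ∃[ u ] (u ≢ c × ¬ c ~ u)

  MaxDegree≤2 : Set
  MaxDegree≤2 = ∀ {c p q r} → p ≢ q → p ≢ r → q ≢ r → c ~ p → c ~ q → c ~ r → ⊥

  noSquare : ∀ {z₁ z₂ a b} → z₁ ≢ z₂ → a ≢ b → z₁ ~ a → z₁ ~ b → z₂ ~ a → z₂ ~ b → ⊥
  noSquare z₁≢z₂ a≢b z₁~a z₁~b z₂~a z₂~b =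
    noConfig (twoZeroConfig z₁≢z₂ z₁~a z₁~b z₂~a z₂~b a≢b a≢b a≢b a≢b Edge-irrefl Edge-irrefl
                            (Edge⇒≢ z₁~a) (Edge⇒≢ z₁~b) (Edge⇒≢ z₂~a) (Edge⇒≢ z₂~b))

  ~-≁⇒≢ : ∀ {u a b} → u ~ a → ¬ u ~ b → a ≢ b
  ~-≁⇒≢ u~a u≁b refl = u≁b u~a

  vertexWithTwoNeighbours : ∃[ x ] ∃[ p ] ∃[ q ] (p ≢ q × x ~ p × x ~ q)
  vertexWithTwoNeighbours with any? (λ x → any? (λ p → any? (λ q → ¬? (p ≟ q) ×-dec Edge? x p ×-dec Edge? x q)))
  ... | yes found = found
  ... | no none = ⊥-elim (1≢2 (atMostOne (reach 0F 1F (λ ())) (reach 0F 2F (λ ()))))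
    where
      atMostOne : ∀ {x p q} → x ~ p → x ~ q → p ≡ q
      atMostOne {x} {p} {q} x~p x~q with p ≟ q
      ... | yes p≡q = p≡q
      ... | no p≢q = ⊥-elim (none (x , p , q , p≢q , x~p , x~q))
      walk⇒adjacent : ∀ {u w} → Walk G u w → w ≡ u ⊎ u ~ w
      walk⇒adjacent here = inj₁ refl
      walk⇒adjacent (step e walk) with walk⇒adjacent walk
      ... | inj₁ refl = inj₂ e
      ... | inj₂ e′ = inj₁ (≡.sym (atMostOne (Edge-sym e) e′))
      reach : ∀ u w → w ≢ u → u ~ w
      reach u w w≢u = [ ⊥-elim ∘ w≢u , (λ e → e) ]′ (walk⇒adjacent (connected u w))
      1≢2 : 1F ≢ 2F
      1≢2 ()

  distanceTwo : ∀ c → NotDominating c → ∃[ v ] ∃[ y ] (c ~ v × v ~ y × y ≢ c × ¬ c ~ y)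
  distanceTwo c (u , u≢c , c≁u)
    with leavingEdge (λ w → w ≡ c ⊎ c ~ w) (λ w → w ≟ c ⊎-dec Edge? c w) (connected c u)
                     (inj₁ refl) [ u≢c , c≁u ]′
  ... | a , b , a~b , inj₁ refl , b∉N[c] = ⊥-elim (b∉N[c] (inj₂ a~b))
  ... | a , b , a~b , inj₂ c~a , b∉N[c] = a , b , c~a , a~b , b∉N[c] ∘ inj₁ , b∉N[c] ∘ inj₂

  dominatingCase : ∀ c → Dominating c → Family G
  dominatingCase c dominating
    with any? (λ x → any? (λ y → ¬? (x ≟ c) ×-dec ¬? (y ≟ c) ×-dec Edge? x y))
  ... | no noEdge = inj₁ (≅-star c dominating λ s t s≢c t≢c s~t → noEdge (s , t , s≢c , t≢c , s~t))
  ... | yes (x , y , x≢c , y≢c , x~y) =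
    inj₂ (inj₁ (≅-starPlus c x y (≢-sym x≢c) (≢-sym y≢c) (Edge⇒≢ x~y) dominating x~y xPrivate yPrivate rest))
    where
      -- v and w would have the two common neighbours c and u
      noSecondLeafNeighbour : ∀ {u v w} → u ≢ c → v ≢ c → w ≢ c → v ≢ w → u ~ v → u ~ w → ⊥
      noSecondLeafNeighbour u≢c v≢c w≢c v≢w u~v u~w =
        noSquare v≢w (≢-sym u≢c) (Edge-sym (dominating _ v≢c)) (Edge-sym u~v)
                 (Edge-sym (dominating _ w≢c)) (Edge-sym u~w)
      xPrivate : ∀ w → w ≢ c → w ≢ x → w ≢ y → ¬ x ~ w
      xPrivate w w≢c _ w≢y = noSecondLeafNeighbour x≢c y≢c w≢c (≢-sym w≢y) x~y
      yPrivate : ∀ w → w ≢ c → w ≢ x → w ≢ y → ¬ y ~ w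
      yPrivate w w≢c w≢x _ = noSecondLeafNeighbour y≢c x≢c w≢c (≢-sym w≢x) (Edge-sym x~y)
      rest : ∀ s t → s ≢ c → s ≢ x → s ≢ y → t ≢ c → t ≢ x → t ≢ y → ¬ s ~ t
      rest s t s≢c s≢x s≢y t≢c t≢x t≢y s~t =
        noConfig (twoZeroConfig (≢-sym s≢x) (Edge-sym (dominating x x≢c)) x~y (Edge-sym (dominating s s≢c)) s~t
                   (≢-sym y≢c) (≢-sym t≢c) (≢-sym y≢c) (≢-sym t≢c) Edge-irrefl
                   (yPrivate t t≢c t≢x t≢y) x≢c (≢-sym t≢x) s≢c s≢y)

  module HighDegreeCase (c p q r : V) (p≢q : p ≢ q) (p≢r : p ≢ r) (q≢r : q ≢ r)
                        (c~p : c ~ p) (c~q : c ~ q) (c~r : c ~ r)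
                        (v y : V) (c~v : c ~ v) (v~y : v ~ y) (y≢c : y ≢ c) (c≁y : ¬ c ~ y) where

    neighbourAvoiding : ∀ a b → ∃[ s ] (c ~ s × s ≢ a × s ≢ b)
    neighbourAvoiding a b = choose (p ≟ a) (p ≟ b) (q ≟ a) (q ≟ b) (r ≟ a) (r ≟ b)
      where
        choose : Dec (p ≡ a) → Dec (p ≡ b) → Dec (q ≡ a) → Dec (q ≡ b) → Dec (r ≡ a) → Dec (r ≡ b) →
                 ∃[ s ] (c ~ s × s ≢ a × s ≢ b)
        choose (no p≢a) (no p≢b) _ _ _ _ = p , c~p , p≢a , p≢b
        choose _ _ (no q≢a) (no q≢b) _ _ = q , c~q , q≢a , q≢b
        choose _ _ _ _ (no r≢a) (no r≢b) = r , c~r , r≢a , r≢b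
        choose (yes refl) _ (yes refl) _ _ _ = ⊥-elim (p≢q refl)
        choose _ (yes refl) _ (yes refl) _ _ = ⊥-elim (p≢q refl)
        choose (yes refl) _ _ _ (yes refl) _ = ⊥-elim (p≢r refl)
        choose _ (yes refl) _ _ _ (yes refl) = ⊥-elim (p≢r refl)
        choose _ _ (yes refl) _ (yes refl) _ = ⊥-elim (q≢r refl)
        choose _ _ _ (yes refl) _ (yes refl) = ⊥-elim (q≢r refl)

    twoNeighboursAvoiding : ∀ a → ∃[ s₁ ] ∃[ s₂ ] (c ~ s₁ × c ~ s₂ × s₁ ≢ s₂ × s₁ ≢ a × s₂ ≢ a)
    twoNeighboursAvoiding a = choose (p ≟ a) (q ≟ a) (r ≟ a)
      where
        choose : Dec (p ≡ a) → Dec (q ≡ a) → Dec (r ≡ a) →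
                 ∃[ s₁ ] ∃[ s₂ ] (c ~ s₁ × c ~ s₂ × s₁ ≢ s₂ × s₁ ≢ a × s₂ ≢ a)
        choose (no p≢a) (no q≢a) _ = p , q , c~p , c~q , p≢q , p≢a , q≢a
        choose (no p≢a) (yes _) (no r≢a) = p , r , c~p , c~r , p≢r , p≢a , r≢a
        choose (yes _) (no q≢a) (no r≢a) = q , r , c~q , c~r , q≢r , q≢a , r≢a
        choose (yes refl) (yes refl) _ = ⊥-elim (p≢q refl)
        choose (no _) (yes refl) (yes refl) = ⊥-elim (q≢r refl)
        choose (yes refl) (no _) (yes refl) = ⊥-elim (p≢r refl)

    farNeighbour-¬¬adjacent : ∀ {v′ y′ t s} → c ~ v′ → v′ ~ y′ → y′ ≢ c → ¬ c ~ y′ → y′ ~ t → t ≢ v′ → t ≢ c →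
                              c ~ s → s ≢ v′ → ¬ ¬ s ~ t
    farNeighbour-¬¬adjacent c~v′ v′~y′ y′≢c c≁y′ y′~t t≢v′ t≢c c~s s≢v′ s≁t =
      noConfig (twoZeroConfig (≢-sym y′≢c) c~s c~v′ y′~t (Edge-sym v′~y′) s≢v′ s≢v′ t≢v′ t≢v′ s≁t Edge-irrefl
                              (≢-sym t≢c) (Edge⇒≢ c~v′) (λ y′≡s → c≁y′ (subst (c ~_) (≡.sym y′≡s) c~s))
                              (λ y′≡v′ → Edge⇒≢ v′~y′ (≡.sym y′≡v′)))

    distanceTwo-leaf : ∀ {v′ y′} → c ~ v′ → v′ ~ y′ → y′ ≢ c → ¬ c ~ y′ → ∀ t → y′ ~ t → t ≡ v′
    distanceTwo-leaf {v′} {y′} c~v′ v′~y′ y′≢c c≁y′ t y′~t with t ≟ v′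
    ... | yes t≡v′ = t≡v′
    ... | no t≢v′ with t ≟ c
    ...   | yes refl = ⊥-elim (c≁y′ (Edge-sym y′~t))
    ...   | no t≢c with Edge? c t
    ...     | yes c~t = ⊥-elim (noSquare (≢-sym y′≢c) (≢-sym t≢v′) c~v′ c~t (Edge-sym v′~y′) y′~t)
    ...     | no _ with twoNeighboursAvoiding v′
    ...       | s₁ , s₂ , c~s₁ , c~s₂ , s₁≢s₂ , s₁≢v′ , s₂≢v′ with Edge? s₁ t | Edge? s₂ t
    ...         | yes s₁~t | yes s₂~t =
      ⊥-elim (noSquare (≢-sym t≢c) s₁≢s₂ c~s₁ c~s₂ (Edge-sym s₁~t) (Edge-sym s₂~t))
    ...         | no s₁≁t | _ =
      ⊥-elim (farNeighbour-¬¬adjacent c~v′ v′~y′ y′≢c c≁y′ y′~t t≢v′ t≢c c~s₁ s₁≢v′ s₁≁t)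
    ...         | yes _ | no s₂≁t =
      ⊥-elim (farNeighbour-¬¬adjacent c~v′ v′~y′ y′≢c c≁y′ y′~t t≢v′ t≢c c~s₂ s₂≢v′ s₂≁t)

    y-leaf : ∀ t → y ~ t → t ≡ v
    y-leaf = distanceTwo-leaf c~v v~y y≢c c≁y

    Near : V → Set
    Near u = u ≡ c ⊎ c ~ u ⊎ u ≡ y

    noEdgeLeavingNear : ∀ {a b} → a ~ b → Near a → ¬ Near b → ⊥
    noEdgeLeavingNear a~b (inj₁ refl) b∉ = b∉ (inj₂ (inj₁ a~b))
    noEdgeLeavingNear {b = b} a~b (inj₂ (inj₂ refl)) b∉ =
      b∉ (inj₂ (inj₁ (subst (c ~_) (≡.sym (y-leaf b a~b)) c~v)))
    noEdgeLeavingNear {a} {b} a~b (inj₂ (inj₁ c~a)) b∉ with a ≟ v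
    ... | yes refl =
      let (s₁ , s₂ , c~s₁ , c~s₂ , s₁≢s₂ , s₁≢v , s₂≢v) = twoNeighboursAvoiding v in
      noConfig (twoZeroConfig (Edge⇒≢ c~v) c~s₁ c~s₂ v~y a~b s₁≢s₂ (~-≁⇒≢ c~s₁ c≁b)
                 (λ y≡s₂ → c≁y (subst (c ~_) (≡.sym y≡s₂) c~s₂)) (λ y≡b → b∉ (inj₂ (inj₂ (≡.sym y≡b))))
                 (λ s₁~y → s₁≢v (y-leaf _ (Edge-sym s₁~y)))
                 (λ s₂~b → s₂≢v (distanceTwo-leaf c~a a~b (b∉ ∘ inj₁) c≁b _ (Edge-sym s₂~b)))
                 (≢-sym y≢c) (≢-sym (b∉ ∘ inj₁)) (≢-sym s₁≢v) (≢-sym s₂≢v))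
      where
        c≁b : ¬ c ~ b
        c≁b = b∉ ∘ inj₂ ∘ inj₁
    ... | no a≢v =
      noConfig (twoZeroConfig (≢-sym a≢v) v~y (Edge-sym c~v) a~b (Edge-sym c~a) y≢c y≢c (b∉ ∘ inj₁) (b∉ ∘ inj₁)
                 (λ y~b → b∉ (inj₂ (inj₁ (subst (c ~_) (≡.sym (y-leaf b y~b)) c~v)))) Edge-irrefl
                 (~-≁⇒≢ c~v (b∉ ∘ inj₂ ∘ inj₁)) (λ v≡c → Edge⇒≢ c~v (≡.sym v≡c))
                 (~-≁⇒≢ c~a c≁y) (λ a≡c → Edge⇒≢ c~a (≡.sym a≡c)))

    c-dominatesAllBut-y : ∀ w → w ≢ y → w ≢ c → c ~ w
    c-dominatesAllBut-y w w≢y w≢c with Edge? c w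
    ... | yes c~w = c~w
    ... | no c≁w with leavingEdge Near (λ u → u ≟ c ⊎-dec Edge? c u ⊎-dec u ≟ y) (connected c w) (inj₁ refl)
                                  [ w≢c , [ c≁w , w≢y ]′ ]′
    ...   | _ , _ , a~b , a-near , b-far = ⊥-elim (noEdgeLeavingNear a~b a-near b-far)

    v-neighbours : ∀ t → v ~ t → t ≡ c ⊎ t ≡ y
    v-neighbours t v~t with t ≟ c | t ≟ y
    ... | yes t≡c | _ = inj₁ t≡c
    ... | no _ | yes t≡y = inj₂ t≡y
    ... | no t≢c | no t≢y =
      let (s , c~s , s≢v , s≢t) = neighbourAvoiding v t in
      ⊥-elim (noConfig (twoZeroConfig (Edge⇒≢ c~v) c~s (c-dominatesAllBut-y t t≢y t≢c) v~y v~t s≢t s≢t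
                         (≢-sym t≢y) (≢-sym t≢y) (λ s~y → s≢v (y-leaf s (Edge-sym s~y))) Edge-irrefl
                         (≢-sym y≢c) (≢-sym t≢c) (≢-sym s≢v) (Edge⇒≢ v~t)))

    rest : ∀ s t → s ≢ c → s ≢ v → s ≢ y → t ≢ c → t ≢ v → t ≢ y → ¬ s ~ t
    rest s t s≢c s≢v s≢y t≢c t≢v t≢y s~t =
      noConfig (twoZeroConfig (≢-sym s≢v) v~y (Edge-sym c~v) s~t (Edge-sym (c-dominatesAllBut-y s s≢y s≢c))
                 y≢c y≢c t≢c t≢c (λ y~t → t≢v (y-leaf t y~t)) Edge-irrefl (≢-sym t≢v)
                 (λ v≡c → Edge⇒≢ c~v (≡.sym v≡c)) s≢y s≢c)

    doubleStar : Family G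
    doubleStar =
      let (d , c~d , d≢v , d≢y) = neighbourAvoiding v y in
      inj₂ (inj₂ (inj₁ (≅-doubleStar c v y d (Edge⇒≢ c~v) (≢-sym y≢c) (Edge⇒≢ v~y) (≢-sym (Edge⇒≢ c~d)) d≢v d≢y
                          c~v v~y c≁y y-leaf v-neighbours c-dominatesAllBut-y rest)))

  atMostTwoNeighbours : MaxDegree≤2 → ∀ {c a b t} → c ~ a → c ~ b → a ≢ b → c ~ t → t ≡ a ⊎ t ≡ b
  atMostTwoNeighbours maxDegree {a = a} {b} {t} c~a c~b a≢b c~t with t ≟ a | t ≟ b
  ... | yes t≡a | _ = inj₁ t≡a
  ... | no _ | yes t≡b = inj₂ t≡b
  ... | no t≢a | no t≢b = ⊥-elim (maxDegree a≢b (≢-sym t≢a) (≢-sym t≢b) c~a c~b c~t)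

  -- p, x, q, w is an induced path; G is this path or a 5-cycle through it.
  module MaxDegreeTwoCase (maxDegree : MaxDegree≤2) (x p q w : V) (p≢q : p ≢ q)
                          (x~p : x ~ p) (x~q : x ~ q) (q~w : q ~ w) (w≢x : w ≢ x) (x≁w : ¬ x ~ w) where

    x-neighbours : ∀ t → x ~ t → t ≡ p ⊎ t ≡ q
    x-neighbours t = atMostTwoNeighbours maxDegree x~p x~q p≢q

    q-neighbours : ∀ t → q ~ t → t ≡ x ⊎ t ≡ w
    q-neighbours t = atMostTwoNeighbours maxDegree (Edge-sym x~q) q~w (≢-sym w≢x)

    p≁w : ¬ p ~ w
    p≁w p~w = noSquare (≢-sym w≢x) p≢q x~p x~q (Edge-sym p~w) (Edge-sym q~w)

    p≢w : p ≢ w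
    p≢w = ~-≁⇒≢ x~p x≁w

    p≁q : ¬ p ~ q
    p≁q p~q = [ Edge⇒≢ x~p ∘ ≡.sym , (λ p≡w → x≁w (subst (x ~_) p≡w x~p)) ]′ (q-neighbours p (Edge-sym p~q))

    cycle : ∀ t → w ~ t → t ≢ q → t ~ p → Family G
    cycle t w~t t≢q t~p = inj₂ (inj₂ (inj₂ (≅-cycle₅ G vertex onto table)))
      where
        t≢x : t ≢ x
        t≢x t≡x = x≁w (Edge-sym (subst (w ~_) t≡x w~t))
        t≢p : t ≢ p
        t≢p t≡p = p≁w (Edge-sym (subst (w ~_) t≡p w~t))
        x≁t : ¬ x ~ t
        x≁t x~t = [ t≢p , t≢q ]′ (x-neighbours t x~t)
        q≁t : ¬ q ~ t
        q≁t q~t = [ t≢x , (λ t≡w → Edge⇒≢ w~t (≡.sym t≡w)) ]′ (q-neighbours t q~t)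
        vertex : Fin 5 → V
        vertex 0F = x
        vertex 1F = q
        vertex 2F = w
        vertex 3F = t
        vertex 4F = p
        neighbours : ∀ i {u} → vertex i ~ u → ∃[ j ] vertex j ≡ u
        neighbours 0F x~u = [ (λ u≡p → 4F , ≡.sym u≡p) , (λ u≡q → 1F , ≡.sym u≡q) ]′ (x-neighbours _ x~u)
        neighbours 1F q~u = [ (λ u≡x → 0F , ≡.sym u≡x) , (λ u≡w → 2F , ≡.sym u≡w) ]′ (q-neighbours _ q~u)
        neighbours 2F w~u = [ (λ u≡q → 1F , ≡.sym u≡q) , (λ u≡t → 3F , ≡.sym u≡t) ]′
                              (atMostTwoNeighbours maxDegree (Edge-sym q~w) w~t (≢-sym t≢q) w~u)
        neighbours 3F t~u = [ (λ u≡w → 2F , ≡.sym u≡w) , (λ u≡p → 4F , ≡.sym u≡p) ]′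
                              (atMostTwoNeighbours maxDegree (Edge-sym w~t) t~p (≢-sym p≢w) t~u)
        neighbours 4F p~u = [ (λ u≡t → 3F , ≡.sym u≡t) , (λ u≡x → 0F , ≡.sym u≡x) ]′
                              (atMostTwoNeighbours maxDegree (Edge-sym t~p) (Edge-sym x~p) t≢x p~u)
        onto : ∀ u → ∃[ i ] vertex i ≡ u
        onto u = walk-closed (λ a → ∃[ i ] vertex i ≡ a) (λ { (i , refl) → neighbours i })
                             (connected x u) (0F , refl)
        table : ∀ i j → adj G (vertex i) (vertex j) ≡ cycleAdj i j
        table 0F 0F = ¬-not Edge-irrefl
        table 0F 1F = x~q
        table 0F 2F = ¬-not x≁w
        table 0F 3F = ¬-not x≁t
        table 0F 4F = x~p
        table 1F 0F = Edge-sym x~q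
        table 1F 1F = ¬-not Edge-irrefl
        table 1F 2F = q~w
        table 1F 3F = ¬-not q≁t
        table 1F 4F = ¬-not (p≁q ∘ Edge-sym)
        table 2F 0F = ¬-not (x≁w ∘ Edge-sym)
        table 2F 1F = Edge-sym q~w
        table 2F 2F = ¬-not Edge-irrefl
        table 2F 3F = w~t
        table 2F 4F = ¬-not (p≁w ∘ Edge-sym)
        table 3F 0F = ¬-not (x≁t ∘ Edge-sym)
        table 3F 1F = ¬-not (q≁t ∘ Edge-sym)
        table 3F 2F = Edge-sym w~t
        table 3F 3F = ¬-not Edge-irrefl
        table 3F 4F = t~p
        table 4F 0F = Edge-sym x~p
        table 4F 1F = ¬-not p≁q
        table 4F 2F = ¬-not p≁w
        table 4F 3F = Edge-sym t~p
        table 4F 4F = ¬-not Edge-irrefl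

    path : (∀ t → w ~ t → t ≡ q) → (∀ s → p ~ s → s ≡ x) → Family G
    path w-leaf p-leaf =
      inj₂ (inj₂ (inj₁ (≅-doubleStar x q w p (Edge⇒≢ x~q) (≢-sym w≢x) (Edge⇒≢ q~w) (≢-sym (Edge⇒≢ x~p)) p≢q p≢w
                          x~q q~w x≁w w-leaf q-neighbours x-dominatesAllBut-w rest)))
      where
        vertex : Fin 4 → V
        vertex 0F = x
        vertex 1F = p
        vertex 2F = q
        vertex 3F = w
        neighbours : ∀ i {u} → vertex i ~ u → ∃[ j ] vertex j ≡ u
        neighbours 0F x~u = [ (λ u≡p → 1F , ≡.sym u≡p) , (λ u≡q → 2F , ≡.sym u≡q) ]′ (x-neighbours _ x~u)
        neighbours 1F p~u = 0F , ≡.sym (p-leaf _ p~u)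
        neighbours 2F q~u = [ (λ u≡x → 0F , ≡.sym u≡x) , (λ u≡w → 3F , ≡.sym u≡w) ]′ (q-neighbours _ q~u)
        neighbours 3F w~u = 2F , ≡.sym (w-leaf _ w~u)
        onto : ∀ u → ∃[ i ] vertex i ≡ u
        onto u = walk-closed (λ a → ∃[ i ] vertex i ≡ a) (λ { (i , refl) → neighbours i })
                             (connected x u) (0F , refl)
        x-dominatesAllBut-w : ∀ u → u ≢ w → u ≢ x → x ~ u
        x-dominatesAllBut-w u u≢w u≢x with onto u
        ... | 0F , refl = ⊥-elim (u≢x refl)
        ... | 1F , refl = x~p
        ... | 2F , refl = x~q
        ... | 3F , refl = ⊥-elim (u≢w refl)
        onlyP : ∀ {s} → s ≢ x → s ≢ q → s ≢ w → s ≡ p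
        onlyP {s} s≢x s≢q s≢w with onto s
        ... | 0F , refl = ⊥-elim (s≢x refl)
        ... | 1F , refl = refl
        ... | 2F , refl = ⊥-elim (s≢q refl)
        ... | 3F , refl = ⊥-elim (s≢w refl)
        rest : ∀ s t → s ≢ x → s ≢ q → s ≢ w → t ≢ x → t ≢ q → t ≢ w → ¬ s ~ t
        rest s t s≢x s≢q s≢w t≢x t≢q t≢w s~t with onlyP s≢x s≢q s≢w | onlyP t≢x t≢q t≢w
        ... | refl | refl = Edge-irrefl s~t

    pathOrCycle : Family G
    pathOrCycle with any? (λ t → Edge? w t ×-dec ¬? (t ≟ q))
    ... | yes (t , w~t , t≢q) with Edge? t p
    ...   | yes t~p = cycle t w~t t≢q t~p
    ...   | no t≁p =
      ⊥-elim (noConfig (twoZeroConfig (≢-sym w≢x) x~p x~q w~t (Edge-sym q~w) p≢q p≢q t≢q t≢q (t≁p ∘ Edge-sym)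
                         Edge-irrefl (λ x≡t → x≁w (Edge-sym (subst (w ~_) (≡.sym x≡t) w~t))) (Edge⇒≢ x~q)
                         (≢-sym p≢w) (λ w≡q → Edge⇒≢ q~w (≡.sym w≡q))))
    pathOrCycle | no w-onlyQ with any? (λ s → Edge? p s ×-dec ¬? (s ≟ x))
    ... | no p-onlyX = path (onlyNeighbour w-onlyQ) (onlyNeighbour p-onlyX)
    ... | yes (s , p~s , s≢x) =
      ⊥-elim (noConfig (twoZeroConfig (≢-sym p≢q) q~w (Edge-sym x~q) p~s (Edge-sym x~p) w≢x w≢x s≢x s≢x
                         (λ w~s → s≢q (onlyNeighbour w-onlyQ s w~s)) Edge-irrefl (≢-sym s≢q)
                         (λ q≡x → Edge⇒≢ x~q (≡.sym q≡x)) p≢w (λ p≡x → Edge⇒≢ x~p (≡.sym p≡x))))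
      where
        s≢q : s ≢ q
        s≢q s≡q = p≁q (subst (p ~_) s≡q p~s)

  maxDegreeTwoCase : MaxDegree≤2 → (∀ c → NotDominating c) → Family G
  maxDegreeTwoCase maxDegree notDominating with vertexWithTwoNeighbours
  ... | x , p , q , p≢q , x~p , x~q with distanceTwo x (notDominating x)
  ...   | v , w , x~v , v~w , w≢x , x≁w with atMostTwoNeighbours maxDegree x~p x~q p≢q x~v
  ...     | inj₁ refl = MaxDegreeTwoCase.pathOrCycle maxDegree x q p w (≢-sym p≢q) x~q x~p v~w w≢x x≁w
  ...     | inj₂ refl = MaxDegreeTwoCase.pathOrCycle maxDegree x p q w p≢q x~p x~q v~w w≢x x≁w

  notDominating : ¬ ∃ Dominating → ∀ c → NotDominating c
  notDominating noneDominating c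
    with ¬∀⟶∃¬ _ (λ u → u ≢ c → c ~ u) (λ u → ¬? (u ≟ c) →-dec Edge? c u) (λ dom → noneDominating (c , dom))
  ... | u , ¬[u≢c→c~u] = u , (λ u≡c → ¬[u≢c→c~u] (λ u≢c → ⊥-elim (u≢c u≡c))) , (λ c~u → ¬[u≢c→c~u] (λ _ → c~u))

  classify : Family G
  classify with any? (λ c → all? (λ u → ¬? (u ≟ c) →-dec Edge? c u))
  ... | yes (c , dominating) = dominatingCase c dominating
  ... | no noneDominating
    with any? (λ c → any? (λ p → any? (λ q → any? (λ r →
           ¬? (p ≟ q) ×-dec ¬? (p ≟ r) ×-dec ¬? (q ≟ r) ×-dec Edge? c p ×-dec Edge? c q ×-dec Edge? c r))))
  ...   | no noneOfDegree≥3 =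
    maxDegreeTwoCase
      (λ p≢q p≢r q≢r c~p c~q c~r → noneOfDegree≥3 (_ , _ , _ , _ , p≢q , p≢r , q≢r , c~p , c~q , c~r))
      (notDominating noneDominating)
  ...   | yes (c , p , q , r , p≢q , p≢r , q≢r , c~p , c~q , c~r)
    with distanceTwo c (notDominating noneDominating c)
  ...     | v , y , c~v , v~y , y≢c , c≁y =
    HighDegreeCase.doubleStar c p q r p≢q p≢r q≢r c~p c~q c~r v y c~v v~y y≢c c≁y

-- The four graphs have γri2 = n − 1

Is2RiDF-pullback : ∀ {n} {G M : Graph n} (φ ψ : Fin n → Fin n) → (∀ a → φ (ψ a) ≡ a) →
                   (∀ u v → adj G u v ≡ adj M (φ u) (φ v)) → ∀ {g} → Is2RiDF M g → Is2RiDF G (g ∘ φ)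
Is2RiDF-pullback {G = G} {M} φ ψ φ∘ψ φ-adj {g} R = record
  { indep₁ = λ u v e → indep₁ (φ u) (φ v) (trans (≡.sym (φ-adj u v)) e)
  ; indep₂ = λ u v e → indep₂ (φ u) (φ v) (trans (≡.sym (φ-adj u v)) e)
  ; dom₁   = λ v gv → lift v (dom₁ (φ v) gv)
  ; dom₂   = λ v gv → lift v (dom₂ (φ v) gv)
  }
  where
    open Is2RiDF R
    lift : ∀ v {l} → ∃[ a ] (Edge M (φ v) a × g a ≡ l) → ∃[ u ] (Edge G v u × g (φ u) ≡ l)
    lift v (a , e , ga) =
      ψ a , trans (φ-adj v (ψ a)) (subst (λ b → adj M (φ v) b ≡ true) (≡.sym (φ∘ψ a)) e) ,
            subst (λ b → g b ≡ _) (≡.sym (φ∘ψ a)) ga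

γri2≡n∸1-≅ : ∀ {n} (G M : Graph n) → G ≅ adj M → (g : Fin n → Label) {t : Fin n} → Is2RiDF M g → g t ≡ L0 →
             (∀ h → Is2RiDF M h → AtMostOneZero h) → γri2≡ G (n ∸ 1)
γri2≡n∸1-≅ G M (π , π-adj) g {t} g-2RiDF gt≡L0 unique =
  γri2≡n∸1 G (g ∘ φ) (Is2RiDF-pullback φ ψ φ∘ψ π-adj g-2RiDF) (trans (cong g (φ∘ψ t)) gt≡L0) unique′
  where
    φ = π ⟨$⟩ʳ_
    ψ = π ⟨$⟩ˡ_
    φ∘ψ : ∀ a → φ (ψ a) ≡ a
    φ∘ψ a = Perm.inverseʳ π
    ψ∘φ : ∀ u → ψ (φ u) ≡ u
    ψ∘φ u = Perm.inverseˡ π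
    ψ-adj : ∀ a b → adj M a b ≡ adj G (ψ a) (ψ b)
    ψ-adj a b = trans (cong₂ (adj M) (≡.sym (φ∘ψ a)) (≡.sym (φ∘ψ b))) (≡.sym (π-adj (ψ a) (ψ b)))
    unique′ : ∀ f → Is2RiDF G f → AtMostOneZero f
    unique′ f f-2RiDF {x} {y} fx fy =
      trans (≡.sym (ψ∘φ x)) (trans (cong ψ (unique (f ∘ ψ) (Is2RiDF-pullback ψ φ ψ∘φ ψ-adj f-2RiDF)
                                                   (trans (cong f (ψ∘φ x)) fx) (trans (cong f (ψ∘φ y)) fy)))
                                   (ψ∘φ y))

data OppositeLabels {n : ℕ} (f : Fin n → Label) (a b : Fin n) : Set where
  opposite₁₂ : f a ≡ L1 → f b ≡ L2 → OppositeLabels f a b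
  opposite₂₁ : f a ≡ L2 → f b ≡ L1 → OppositeLabels f a b

module _ {l : Label} where

  L1-≢L0 : l ≡ L1 → l ≢ L0
  L1-≢L0 refl ()

  L2-≢L0 : l ≡ L2 → l ≢ L0
  L2-≢L0 refl ()

module _ {n : ℕ} {f : Fin n → Label} {a b : Fin n} where

  opposite-nonzeroˡ : OppositeLabels f a b → f a ≢ L0
  opposite-nonzeroˡ (opposite₁₂ fa _) = L1-≢L0 fa
  opposite-nonzeroˡ (opposite₂₁ fa _) = L2-≢L0 fa

  opposite-nonzeroʳ : OppositeLabels f a b → f b ≢ L0
  opposite-nonzeroʳ (opposite₁₂ _ fb) = L2-≢L0 fb
  opposite-nonzeroʳ (opposite₂₁ _ fb) = L1-≢L0 fb

module _ {n : ℕ} {G : Graph n} {f : Fin n → Label} (f-2RiDF : Is2RiDF G f) where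
  open Is2RiDF f-2RiDF

  oneNeighbour⇒nonzero : ∀ {v a} → (∀ u → Edge G v u → u ≡ a) → f v ≢ L0
  oneNeighbour⇒nonzero only-a fv≡L0 with dom₁ _ fv≡L0 | dom₂ _ fv≡L0
  ... | u₁ , e₁ , fu₁ | u₂ , e₂ , fu₂ with only-a u₁ e₁ | only-a u₂ e₂
  ... | refl | refl = L1≢L2 (trans (≡.sym fu₁) fu₂)

  twoNeighbours⇒opposite : ∀ {v a b} → (∀ u → Edge G v u → u ≡ a ⊎ u ≡ b) → f v ≡ L0 →
                           OppositeLabels f a b
  twoNeighbours⇒opposite only-ab fv≡L0 with dom₁ _ fv≡L0 | dom₂ _ fv≡L0
  ... | u₁ , e₁ , fu₁ | u₂ , e₂ , fu₂ with only-ab u₁ e₁ | only-ab u₂ e₂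
  ... | inj₁ refl | inj₁ refl = ⊥-elim (L1≢L2 (trans (≡.sym fu₁) fu₂))
  ... | inj₁ refl | inj₂ refl = opposite₁₂ fu₁ fu₂
  ... | inj₂ refl | inj₁ refl = opposite₂₁ fu₂ fu₁
  ... | inj₂ refl | inj₂ refl = ⊥-elim (L1≢L2 (trans (≡.sym fu₁) fu₂))

  opposite-chain-nonadjacent : ∀ {a b c} → OppositeLabels f a b → OppositeLabels f b c → ¬ Edge G a c
  opposite-chain-nonadjacent (opposite₁₂ _ fb) (opposite₁₂ fb′ _) _ = L1≢L2 (trans (≡.sym fb′) fb)
  opposite-chain-nonadjacent (opposite₁₂ fa _) (opposite₂₁ _ fc) e = indep₁ _ _ e fa fc
  opposite-chain-nonadjacent (opposite₂₁ fa _) (opposite₁₂ _ fc) e = indep₂ _ _ e fa fc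
  opposite-chain-nonadjacent (opposite₂₁ _ fb) (opposite₂₁ fb′ _) _ = L1≢L2 (trans (≡.sym fb) fb′)

module _ {n : ℕ} (G : Graph n) (f : Fin n → Label) where
  open GraphProperties G

  is2RiDF? : Dec (Is2RiDF G f)
  is2RiDF? = map′ toRecord fromRecord
    (independent? L1 ×-dec independent? L2 ×-dec dominating? L1 ×-dec dominating? L2)
    where
      independent? : ∀ l → Dec (∀ u v → ¬ (u ~ v × f u ≡ l × f v ≡ l))
      independent? l = all? λ u → all? λ v → ¬? (Edge? u v ×-dec f u ≟ᴸ l ×-dec f v ≟ᴸ l)
      dominating? : ∀ l → Dec (∀ v → f v ≡ L0 → ∃[ u ] (v ~ u × f u ≡ l))
      dominating? l = all? λ v → f v ≟ᴸ L0 →-dec any? λ u → Edge? v u ×-dec f u ≟ᴸ l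
      toRecord : _ → Is2RiDF G f
      toRecord (i₁ , i₂ , d₁ , d₂) = record
        { indep₁ = λ u v e fu fv → i₁ u v (e , fu , fv)
        ; indep₂ = λ u v e fu fv → i₂ u v (e , fu , fv)
        ; dom₁ = d₁
        ; dom₂ = d₂
        }
      fromRecord : Is2RiDF G f → _
      fromRecord R = (λ u v (e , fu , fv) → indep₁ u v e fu fv) , (λ u v (e , fu , fv) → indep₂ u v e fu fv) ,
                     dom₁ , dom₂
        where open Is2RiDF R

star : ∀ {n} → Graph (suc n)
star = record { adj = starAdj ; sym = λ u v → starPattern-sym (isIndex 0 u) (isIndex 0 v) ; irrefl = loopless }
  where
    loopless : ∀ v → starAdj v v ≡ false
    loopless 0F = refl
    loopless (fsuc _) = refl

starPlus : ∀ {n} → Graph (suc (suc (suc n)))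
starPlus = record
  { adj = starPlusAdj
  ; sym = λ u v → starPlusPattern-sym (isIndex 0 u) (isIndex 1 u) (isIndex 2 u)
                                      (isIndex 0 v) (isIndex 1 v) (isIndex 2 v)
  ; irrefl = loopless }
  where
    loopless : ∀ v → starPlusAdj v v ≡ false
    loopless 0F = refl
    loopless 1F = refl
    loopless 2F = refl
    loopless (fsuc (fsuc (fsuc _))) = refl

doubleStar : ∀ {n} → Graph (suc (suc (suc (suc n))))
doubleStar = record
  { adj = doubleStarAdj
  ; sym = λ u v → doubleStarPattern-sym (isIndex 0 u) (isIndex 1 u) (isIndex 2 u)
                                        (isIndex 0 v) (isIndex 1 v) (isIndex 2 v)
  ; irrefl = loopless }
  where
    loopless : ∀ v → doubleStarAdj v v ≡ false
    loopless 0F = refl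
    loopless 1F = refl
    loopless 2F = refl
    loopless (fsuc (fsuc (fsuc _))) = refl

cycle₅ : Graph 5
cycle₅ = record
  { adj = cycleAdj
  ; sym = toWitness {a? = all? λ u → all? λ v → cycleAdj u v ≟ᴮ cycleAdj v u} _
  ; irrefl = toWitness {a? = all? λ v → cycleAdj v v ≟ᴮ false} _
  }

module _ {m : ℕ} where

  starLabelling : Fin (suc (suc (suc m))) → Label
  starLabelling 0F = L0
  starLabelling 1F = L2
  starLabelling (fsuc (fsuc _)) = L1

  starLabelling-2RiDF : Is2RiDF star starLabelling
  starLabelling-2RiDF = record { indep₁ = indep₁ ; indep₂ = indep₂ ; dom₁ = dom₁ ; dom₂ = dom₂ }
    where
      indep₁ : ∀ u v → Edge star u v → starLabelling u ≡ L1 → starLabelling v ≡ L1 → ⊥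
      indep₁ (fsuc (fsuc _)) 0F _ _ ()
      indep₁ (fsuc (fsuc _)) (fsuc (fsuc _)) () _ _
      indep₂ : ∀ u v → Edge star u v → starLabelling u ≡ L2 → starLabelling v ≡ L2 → ⊥
      indep₂ 1F 0F _ _ ()
      indep₂ 1F 1F () _ _
      dom₁ : ∀ v → starLabelling v ≡ L0 → ∃[ u ] (Edge star v u × starLabelling u ≡ L1)
      dom₁ 0F _ = 2F , refl , refl
      dom₁ 1F ()
      dom₁ (fsuc (fsuc _)) ()
      dom₂ : ∀ v → starLabelling v ≡ L0 → ∃[ u ] (Edge star v u × starLabelling u ≡ L2)
      dom₂ 0F _ = 1F , refl , refl
      dom₂ 1F ()
      dom₂ (fsuc (fsuc _)) ()

  star-atMostOneZero : ∀ (f : Fin (suc (suc (suc m))) → Label) → Is2RiDF star f → AtMostOneZero f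
  star-atMostOneZero f f-2RiDF {x} {y} fx fy = trans (centre x fx) (≡.sym (centre y fy))
    where
      leaf : ∀ k u → Edge star (fsuc k) u → u ≡ 0F
      leaf k 0F _ = refl
      centre : ∀ v → f v ≡ L0 → v ≡ 0F
      centre 0F _ = refl
      centre (fsuc k) fv = ⊥-elim (oneNeighbour⇒nonzero f-2RiDF (leaf k) fv)

  starPlusLabelling : Fin (suc (suc (suc m))) → Label
  starPlusLabelling 0F = L0
  starPlusLabelling 1F = L1
  starPlusLabelling 2F = L2
  starPlusLabelling (fsuc (fsuc (fsuc _))) = L1

  starPlusLabelling-2RiDF : Is2RiDF starPlus starPlusLabelling
  starPlusLabelling-2RiDF = record { indep₁ = indep₁ ; indep₂ = indep₂ ; dom₁ = dom₁ ; dom₂ = dom₂ }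
    where
      indep₁ : ∀ u v → Edge starPlus u v → starPlusLabelling u ≡ L1 → starPlusLabelling v ≡ L1 → ⊥
      indep₁ 1F 0F _ _ ()
      indep₁ 1F 1F () _ _
      indep₁ 1F (fsuc (fsuc (fsuc _))) () _ _
      indep₁ (fsuc (fsuc (fsuc _))) 0F _ _ ()
      indep₁ (fsuc (fsuc (fsuc _))) 1F () _ _
      indep₁ (fsuc (fsuc (fsuc _))) (fsuc (fsuc (fsuc _))) () _ _
      indep₂ : ∀ u v → Edge starPlus u v → starPlusLabelling u ≡ L2 → starPlusLabelling v ≡ L2 → ⊥
      indep₂ 2F 2F () _ _
      dom₁ : ∀ v → starPlusLabelling v ≡ L0 → ∃[ u ] (Edge starPlus v u × starPlusLabelling u ≡ L1)
      dom₁ 0F _ = 1F , refl , refl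
      dom₁ 1F ()
      dom₁ 2F ()
      dom₁ (fsuc (fsuc (fsuc _))) ()
      dom₂ : ∀ v → starPlusLabelling v ≡ L0 → ∃[ u ] (Edge starPlus v u × starPlusLabelling u ≡ L2)
      dom₂ 0F _ = 2F , refl , refl
      dom₂ 1F ()
      dom₂ 2F ()
      dom₂ (fsuc (fsuc (fsuc _))) ()

  starPlus-atMostOneZero : ∀ (f : Fin (suc (suc (suc m))) → Label) → Is2RiDF starPlus f → AtMostOneZero f
  starPlus-atMostOneZero f f-2RiDF {x} {y} = zeros x y
    where
      leaf : ∀ k u → Edge starPlus (fsuc (fsuc (fsuc k))) u → u ≡ 0F
      leaf k 0F _ = refl
      neighbours₁ : ∀ u → Edge starPlus 1F u → u ≡ 0F ⊎ u ≡ 2F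
      neighbours₁ 0F _ = inj₁ refl
      neighbours₁ 2F _ = inj₂ refl
      neighbours₂ : ∀ u → Edge starPlus 2F u → u ≡ 0F ⊎ u ≡ 1F
      neighbours₂ 0F _ = inj₁ refl
      neighbours₂ 1F _ = inj₂ refl
      around₁ : f 1F ≡ L0 → OppositeLabels f 0F 2F
      around₁ = twoNeighbours⇒opposite f-2RiDF neighbours₁
      around₂ : f 2F ≡ L0 → OppositeLabels f 0F 1F
      around₂ = twoNeighbours⇒opposite f-2RiDF neighbours₂
      zeros : ∀ a b → f a ≡ L0 → f b ≡ L0 → a ≡ b
      zeros (fsuc (fsuc (fsuc k))) _ fa _ = ⊥-elim (oneNeighbour⇒nonzero f-2RiDF (leaf k) fa)
      zeros _ (fsuc (fsuc (fsuc k))) _ fb = ⊥-elim (oneNeighbour⇒nonzero f-2RiDF (leaf k) fb)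
      zeros 0F 0F _ _ = refl
      zeros 0F 1F fa fb = ⊥-elim (opposite-nonzeroˡ (around₁ fb) fa)
      zeros 0F 2F fa fb = ⊥-elim (opposite-nonzeroˡ (around₂ fb) fa)
      zeros 1F 0F fa fb = ⊥-elim (opposite-nonzeroˡ (around₁ fa) fb)
      zeros 1F 1F _ _ = refl
      zeros 1F 2F fa fb = ⊥-elim (opposite-nonzeroʳ (around₁ fa) fb)
      zeros 2F 0F fa fb = ⊥-elim (opposite-nonzeroˡ (around₂ fa) fb)
      zeros 2F 1F fa fb = ⊥-elim (opposite-nonzeroʳ (around₂ fa) fb)
      zeros 2F 2F _ _ = refl

module _ {m : ℕ} where

  doubleStarLabelling : Fin (suc (suc (suc (suc m)))) → Label
  doubleStarLabelling 0F = L0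
  doubleStarLabelling 1F = L2
  doubleStarLabelling (fsuc (fsuc _)) = L1

  doubleStarLabelling-2RiDF : Is2RiDF doubleStar doubleStarLabelling
  doubleStarLabelling-2RiDF = record { indep₁ = indep₁ ; indep₂ = indep₂ ; dom₁ = dom₁ ; dom₂ = dom₂ }
    where
      indep₁ : ∀ u v → Edge doubleStar u v → doubleStarLabelling u ≡ L1 → doubleStarLabelling v ≡ L1 → ⊥
      indep₁ (fsuc (fsuc _)) 0F _ _ ()
      indep₁ (fsuc (fsuc _)) 1F _ _ ()
      indep₁ 2F 2F () _ _
      indep₁ 2F (fsuc (fsuc (fsuc _))) () _ _
      indep₁ (fsuc (fsuc (fsuc _))) 2F () _ _
      indep₁ (fsuc (fsuc (fsuc _))) (fsuc (fsuc (fsuc _))) () _ _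
      indep₂ : ∀ u v → Edge doubleStar u v → doubleStarLabelling u ≡ L2 → doubleStarLabelling v ≡ L2 → ⊥
      indep₂ 1F 0F _ _ ()
      indep₂ 1F 1F () _ _
      indep₂ 1F (fsuc (fsuc _)) _ _ ()
      dom₁ : ∀ v → doubleStarLabelling v ≡ L0 → ∃[ u ] (Edge doubleStar v u × doubleStarLabelling u ≡ L1)
      dom₁ 0F _ = 3F , refl , refl
      dom₁ 1F ()
      dom₁ (fsuc (fsuc _)) ()
      dom₂ : ∀ v → doubleStarLabelling v ≡ L0 → ∃[ u ] (Edge doubleStar v u × doubleStarLabelling u ≡ L2)
      dom₂ 0F _ = 1F , refl , refl
      dom₂ 1F ()
      dom₂ (fsuc (fsuc _)) ()

  doubleStar-atMostOneZero : ∀ (f : Fin (suc (suc (suc (suc m)))) → Label) → Is2RiDF doubleStar f →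
                             AtMostOneZero f
  doubleStar-atMostOneZero f f-2RiDF {x} {y} = zeros x y
    where
      leaf₂ : ∀ u → Edge doubleStar 2F u → u ≡ 1F
      leaf₂ 1F _ = refl
      leaf : ∀ k u → Edge doubleStar (fsuc (fsuc (fsuc k))) u → u ≡ 0F
      leaf k 0F _ = refl
      leaf k 1F ()
      leaf k (fsuc (fsuc _)) ()
      neighbours₁ : ∀ u → Edge doubleStar 1F u → u ≡ 0F ⊎ u ≡ 2F
      neighbours₁ 0F _ = inj₁ refl
      neighbours₁ 2F _ = inj₂ refl
      nonzero₂ : f 2F ≢ L0
      nonzero₂ = oneNeighbour⇒nonzero f-2RiDF leaf₂
      zeros : ∀ a b → f a ≡ L0 → f b ≡ L0 → a ≡ b
      zeros 2F _ fa _ = ⊥-elim (nonzero₂ fa)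
      zeros _ 2F _ fb = ⊥-elim (nonzero₂ fb)
      zeros (fsuc (fsuc (fsuc k))) _ fa _ = ⊥-elim (oneNeighbour⇒nonzero f-2RiDF (leaf k) fa)
      zeros _ (fsuc (fsuc (fsuc k))) _ fb = ⊥-elim (oneNeighbour⇒nonzero f-2RiDF (leaf k) fb)
      zeros 0F 0F _ _ = refl
      zeros 0F 1F fa fb = ⊥-elim (opposite-nonzeroˡ (twoNeighbours⇒opposite f-2RiDF neighbours₁ fb) fa)
      zeros 1F 0F fa fb = ⊥-elim (opposite-nonzeroˡ (twoNeighbours⇒opposite f-2RiDF neighbours₁ fa) fb)
      zeros 1F 1F _ _ = refl

cycle₅Labelling : Fin 5 → Label
cycle₅Labelling 0F = L0
cycle₅Labelling 1F = L1
cycle₅Labelling 2F = L2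
cycle₅Labelling 3F = L1
cycle₅Labelling 4F = L2

cycle₅Labelling-2RiDF : Is2RiDF cycle₅ cycle₅Labelling
cycle₅Labelling-2RiDF = toWitness {a? = is2RiDF? cycle₅ cycle₅Labelling} _

next prev : Fin 5 → Fin 5
next 0F = 1F
next 1F = 2F
next 2F = 3F
next 3F = 4F
next 4F = 0F
prev 0F = 4F
prev 1F = 0F
prev 2F = 1F
prev 3F = 2F
prev 4F = 3F

module _ where
  open GraphProperties cycle₅

  cycle₅-neighbours : ∀ i u → i ~ u → u ≡ prev i ⊎ u ≡ next i
  cycle₅-neighbours = toWitness {a? = all? λ i → all? λ u → Edge? i u →-dec (u ≟ prev i ⊎-dec u ≟ next i)} _

  cycle₅-chord : ∀ i → prev i ~ next (next (next i))
  cycle₅-chord = toWitness {a? = all? λ i → Edge? (prev i) (next (next (next i)))} _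

  prev∘next : ∀ i → prev (next i) ≡ i
  prev∘next = toWitness {a? = all? λ i → prev (next i) ≟ i} _

  cycle₅-positions : ∀ i j → i ≡ j ⊎ j ≡ next i ⊎ j ≡ prev i ⊎ j ≡ next (next i) ⊎ i ≡ next (next j)
  cycle₅-positions = toWitness {a? = all? λ i → all? λ j →
    i ≟ j ⊎-dec j ≟ next i ⊎-dec j ≟ prev i ⊎-dec j ≟ next (next i) ⊎-dec i ≟ next (next j)} _

module _ (f : Fin 5 → Label) (f-2RiDF : Is2RiDF cycle₅ f) where

  private
    around : ∀ i → f i ≡ L0 → OppositeLabels f (prev i) (next i)
    around i = twoNeighbours⇒opposite f-2RiDF (cycle₅-neighbours i)

    noZerosAtDistanceTwo : ∀ i → f i ≡ L0 → f (next (next i)) ≢ L0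
    noZerosAtDistanceTwo i fi fj =
      opposite-chain-nonadjacent f-2RiDF (around i fi)
        (subst (λ k → OppositeLabels f k (next (next (next i)))) (prev∘next (next i)) (around _ fj))
        (cycle₅-chord i)

  cycle₅-atMostOneZero : AtMostOneZero f
  cycle₅-atMostOneZero {i} {j} fi fj with cycle₅-positions i j
  ... | inj₁ i≡j = i≡j
  ... | inj₂ (inj₁ refl) = ⊥-elim (opposite-nonzeroʳ (around i fi) fj)
  ... | inj₂ (inj₂ (inj₁ refl)) = ⊥-elim (opposite-nonzeroˡ (around i fi) fj)
  ... | inj₂ (inj₂ (inj₂ (inj₁ refl))) = ⊥-elim (noZerosAtDistanceTwo i fi fj)
  ... | inj₂ (inj₂ (inj₂ (inj₂ refl))) = ⊥-elim (noZerosAtDistanceTwo j fj fi)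

γri2≡n∸1-star : ∀ {m} (G : Graph (suc (suc (suc m)))) → G ≅ starAdj → γri2≡ G (suc (suc m))
γri2≡n∸1-star G G≅star =
  γri2≡n∸1-≅ G star G≅star starLabelling {0F} starLabelling-2RiDF refl star-atMostOneZero

γri2≡n∸1-starPlus : ∀ {m} (G : Graph (suc (suc (suc m)))) → G ≅ starPlusAdj → γri2≡ G (suc (suc m))
γri2≡n∸1-starPlus G G≅starPlus =
  γri2≡n∸1-≅ G starPlus G≅starPlus starPlusLabelling {0F} starPlusLabelling-2RiDF refl starPlus-atMostOneZero

γri2≡n∸1-doubleStar : ∀ {m} (G : Graph (suc (suc (suc m)))) → suc (suc (suc m)) ≥ 4 → G ≅ doubleStarAdj →
                      γri2≡ G (suc (suc m))
γri2≡n∸1-doubleStar {zero} G (s≤s (s≤s (s≤s ()))) _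
γri2≡n∸1-doubleStar {suc m} G _ G≅doubleStar =
  γri2≡n∸1-≅ G doubleStar G≅doubleStar doubleStarLabelling {0F} doubleStarLabelling-2RiDF refl
             doubleStar-atMostOneZero

γri2≡n∸1-cycle₅ : ∀ {n} (G : Graph n) → n ≡ 5 → G ≅ cycleAdj → γri2≡ G (n ∸ 1)
γri2≡n∸1-cycle₅ G refl G≅cycle₅ =
  γri2≡n∸1-≅ G cycle₅ G≅cycle₅ cycle₅Labelling {0F} cycle₅Labelling-2RiDF refl cycle₅-atMostOneZero

theorem3 : ∀ (n : ℕ) → n ≥ 3 → (G : Graph n) → Connected G →
    γri2≡ G (n ∸ 1) ⇔
      ((G ≅ starAdj) ⊎ (G ≅ starPlusAdj) ⊎ ((n ≥ 4) × (G ≅ doubleStarAdj))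
        ⊎ ((n ≡ 5) × (G ≅ cycleAdj)))
theorem3 (suc (suc (suc m))) (s≤s (s≤s (s≤s _))) G connected = mk⇔ classify realise
  where
    classify : γri2≡ G (suc (suc m)) → Family G
    classify γ = Classification.classify G (noTwoZeroConfig G (γri2≡n∸1⇒atMostOneZero G γ)) connected
    realise : Family G → γri2≡ G (suc (suc m))
    realise (inj₁ G≅star) = γri2≡n∸1-star G G≅star
    realise (inj₂ (inj₁ G≅starPlus)) = γri2≡n∸1-starPlus G G≅starPlus
    realise (inj₂ (inj₂ (inj₁ (n≥4 , G≅doubleStar)))) = γri2≡n∸1-doubleStar G n≥4 G≅doubleStar
    realise (inj₂ (inj₂ (inj₂ (n≡5 , G≅cycle₅)))) = γri2≡n∸1-cycle₅ G n≡5 G≅cycle₅
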